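{- Let $k$ be a positive integer and let $\mathcal{C}$ be the class of all (abelian) groups isomorphic to subgroups of $(\mathbb{Q}^k,+)$. Let $\{p_i:i\in\omega\}$ be a listing of the rational primes. Let $\mathcal{A}=\mathbb{Z}^k$. For $X\subseteq\omega$ let $\mathcal{V}_X=\{p_i:i\in X\}$ and $\mathcal{A}_X=(O_{\mathbb{Q},\mathcal{V}_X})^k$, where $O_{\mathbb{Q},\mathcal{V}}=\{z\in\mathbb{Q}: \mathrm{ord}_p z\geq 0$ for all primes $p\notin\mathcal{V}\}$ (i.e. the rationals whose denominators involve only primes in $\mathcal{V}$). For $i\in\omega$ let $\mathcal{A}_i=(O_{\mathbb{Q},\{p_i\}})^k$. Then the Richter hypotheses (as defined in the context) are satisfied by $\mathcal{C}$, $\{\mathcal{A}_i\}$, $\mathcal{A}$ and $X\mapsto\mathcal{A}_X$.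
   Context: Structures (here groups in the language $\{+,0\}$ or similar finite language) are countable with universe a subset of $\omega$; the Turing degree of a structure is that of its atomic diagram, and "computable in $\mathcal{B}$" means computable relative to the atomic diagram of $\mathcal{B}$. Richter hypotheses for a class $\mathcal{C}$ closed under isomorphism, a computable sequence $\{\mathcal{A}_i\}$ of computable structures in $\mathcal{C}$, a structure $\mathcal{A}$, and an assignment $X\mapsto\mathcal{A}_X$: (1) $\mathcal{A}\in\mathcal{C}$ is finitely generated and $\mathcal{A}\subset\mathcal{A}_i$ for all $i$; (2) for every $X\subseteq\omega$, $\mathcal{A}_X\in\mathcal{C}$, $\mathcal{A}\subset\mathcal{A}_X$, $\mathcal{A}_X\leq_T X$, and for every $i$ there is an embedding $\sigma:\mathcal{A}_i\hookrightarrow\mathcal{A}_X$ with $\sigma|_{\mathcal{A}}=\mathrm{id}$ iff $i\in X$; (3) whenever $\tau:\mathcal{A}_X\to\mathcal{B}$ is an isomorphism, letting $\Lambda$ be the set of pairs $(i,j)$ such that exactly one of $\mathcal{A}_i,\mathcal{A}_j$ has an embedding $\sigma$ into $\mathcal{B}$ with $(\tau^{ -1}\circ\sigma)|_{\mathcal{A}}=\mathrm{id}$, some procedure computable in $\mathcal{B}$ decides for each $(i,j)\in\Lambda$ which one embeds in this way. -}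

module Defs where

open import Data.Nat using (ℕ; zero; suc; _<_; _≡ᵇ_)
open import Data.Nat.Divisibility using (_∣_)
open import Data.Nat.Primality using (Prime)
open import Data.Bool using (Bool; true; false; _∧_; if_then_else_)
open import Data.Fin using (Fin)
open import Data.Vec using (Vec; []; _∷_; zipWith; replicate; map; lookup)
open import Data.Vec.Relation.Unary.All using (All)
open import Data.Product using (Σ; _×_; _,_; ∃)
open import Data.Rational as ℚ using (ℚ; 0ℚ)
open import Relation.Binary.PropositionalEquality using (_≡_)
open import Relation.Nullary using (¬_)

data Code : ℕ → Set where
  zeroC   : ∀ {n} → Code n
  succC   : Code 1
  projC   : ∀ {n} → Fin n → Code n
  compC   : ∀ {m n} → Code m → Vec (Code n) m → Code n
  recC    : ∀ {n} → Code n → Code (suc (suc n)) → Code (suc n)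
  muC     : ∀ {n} → Code (suc n) → Code n
  oracleC : Code 1

b2n : Bool → ℕ
b2n true  = 1
b2n false = 0

mutual
  data Eval (O : ℕ → Bool) : ∀ {n} → Code n → Vec ℕ n → ℕ → Set where
    ev-zero : ∀ {n} {xs : Vec ℕ n} → Eval O zeroC xs 0
    ev-succ : ∀ {x} → Eval O succC (x ∷ []) (suc x)
    ev-proj : ∀ {n} {i : Fin n} {xs} → Eval O (projC i) xs (lookup xs i)
    ev-comp : ∀ {m n} {f : Code m} {gs : Vec (Code n) m} {xs ys y} →
              EvalAll O gs xs ys → Eval O f ys y → Eval O (compC f gs) xs y
    ev-rec0 : ∀ {n} {f : Code n} {g xs y} →
              Eval O f xs y → Eval O (recC f g) (0 ∷ xs) y
    ev-recS : ∀ {n} {f : Code n} {g x xs z y} →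
              Eval O (recC f g) (x ∷ xs) z → Eval O g (x ∷ z ∷ xs) y →
              Eval O (recC f g) (suc x ∷ xs) y
    ev-mu   : ∀ {n} {f : Code (suc n)} {xs y} →
              Eval O f (y ∷ xs) 0 →
              (∀ z → z < y → Σ ℕ λ m → Eval O f (z ∷ xs) (suc m)) →
              Eval O (muC f) xs y
    ev-orc  : ∀ {x} → Eval O oracleC (x ∷ []) (b2n (O x))

  data EvalAll (O : ℕ → Bool) {n : ℕ} : ∀ {m} → Vec (Code n) m → Vec ℕ n → Vec ℕ m → Set where
    []  : ∀ {xs} → EvalAll O [] xs []
    _∷_ : ∀ {m} {g : Code n} {gs : Vec (Code n) m} {xs y ys} →
          Eval O g xs y → EvalAll O gs xs ys → EvalAll O (g ∷ gs) xs (y ∷ ys)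

-- the empty oracle (unrelativized computation)
∅ : ℕ → Bool
∅ _ = false

_≤T_ : (ℕ → Bool) → (ℕ → Bool) → Set
F ≤T O = Σ (Code 1) λ c → ∀ n → Eval O c (n ∷ []) (b2n (F n))

ComputableFun : (ℕ → ℕ) → Set
ComputableFun f = Σ (Code 1) λ c → ∀ n → Eval ∅ c (n ∷ []) (f n)

-- Pairing: a bijective enumeration ℕ ≅ ℕ × ℕ (Cantor, by diagonals)

unpair : ℕ → ℕ × ℕ
unpair zero    = 0 , 0
unpair (suc n) with unpair n
... | zero  , b = suc b , 0
... | suc a , b = a , suc b

-- Structures in the language {+, 0} with universe a subset of ω

record Str : Set where
  field
    dom  : ℕ → Bool
    plus : ℕ → ℕ → ℕ
    zer  : ℕ
open Str public

_∈D_ : ℕ → Str → Set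
a ∈D S = dom S a ≡ true

-- Atomic diagram, coded as a subset of ω:
--  ⟨0,a⟩      : a is in the universe
--  ⟨1,a,b,c⟩  : a + b = c  (a,b,c in the universe)
--  ⟨2,a⟩      : 0 = a      (a in the universe)
diag : Str → ℕ → Bool
diag S n with unpair n
... | 0 , r = dom S r
... | 1 , r with unpair r
...   | a , r2 with unpair r2
...     | b , c = dom S a ∧ dom S b ∧ dom S c ∧ (plus S a b ≡ᵇ c)
diag S n | 2 , r = dom S r ∧ (zer S ≡ᵇ r)
diag S n | suc (suc (suc _)) , r = false

record _⊂_ (A B : Str) : Set where
  field
    sub-dom  : ∀ a → a ∈D A → a ∈D B
    sub-plus : ∀ a b → a ∈D A → b ∈D A → plus A a b ≡ plus B a b
    sub-zer  : zer A ≡ zer B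

record Embedding (S T : Str) (σ : ℕ → ℕ) : Set where
  field
    emb-dom  : ∀ a → a ∈D S → σ a ∈D T
    emb-inj  : ∀ a b → a ∈D S → b ∈D S → σ a ≡ σ b → a ≡ b
    emb-plus : ∀ a b → a ∈D S → b ∈D S → σ (plus S a b) ≡ plus T (σ a) (σ b)
    emb-zer  : σ (zer S) ≡ zer T

record Iso (S T : Str) (τ : ℕ → ℕ) : Set where
  field
    iso-emb  : Embedding S T τ
    iso-surj : ∀ b → b ∈D T → Σ ℕ λ a → a ∈D S × τ a ≡ b

data Gen (S : Str) (gs : ℕ → Set) : ℕ → Set where
  g-gen  : ∀ {a} → gs a → Gen S gs a
  g-zer  : Gen S gs (zer S)
  g-plus : ∀ {a b} → Gen S gs a → Gen S gs b → Gen S gs (plus S a b)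

FinitelyGenerated : Str → Set
FinitelyGenerated S = Σ ℕ λ n → Σ (Vec ℕ n) λ gs →
  All (λ g → g ∈D S) gs × (∀ a → a ∈D S → Gen S (λ x → Data.Vec.Membership.Propositional._∈_ x gs) a)
  where import Data.Vec.Membership.Propositional

_+v_ : ∀ {k} → Vec ℚ k → Vec ℚ k → Vec ℚ k
_+v_ = zipWith ℚ._+_

0v : ∀ {k} → Vec ℚ k
0v = replicate _ 0ℚ

-v_ : ∀ {k} → Vec ℚ k → Vec ℚ k
-v_ = map (λ q → ℚ.- q)

record HomEmb {k} (S : Str) (ι : ℕ → Vec ℚ k) : Set where
  field
    zer-dom  : zer S ∈D S
    plus-dom : ∀ a b → a ∈D S → b ∈D S → plus S a b ∈D S
    ι-inj    : ∀ a b → a ∈D S → b ∈D S → ι a ≡ ι b → a ≡ b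
    ι-plus   : ∀ a b → a ∈D S → b ∈D S → ι (plus S a b) ≡ ι a +v ι b
    ι-zer    : ι (zer S) ≡ 0v

-- The class C: groups isomorphic to a subgroup of (ℚ^k,+)
-- (S ≅ image of ι, and the image is closed under negation)
InC : ℕ → Str → Set
InC k S = Σ (ℕ → Vec ℚ k) λ ι → HomEmb S ι ×
  (∀ a → a ∈D S → Σ ℕ λ b → b ∈D S × ι b ≡ -v (ι a))

Presents : ∀ {k} → Str → (Vec ℚ k → Set) → (ℕ → Vec ℚ k) → Set
Presents S P ι = HomEmb S ι × (∀ a → a ∈D S → P (ι a)) ×
  (∀ v → P v → Σ ℕ λ a → a ∈D S × ι a ≡ v)

IntVec : ∀ {k} → Vec ℚ k → Set
IntVec = All (λ q → ℚ.denominatorℕ q ≡ 1)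

InO : (ℕ → Set) → ℚ → Set
InO V z = ∀ r → Prime r → r ∣ ℚ.denominatorℕ z → V r

OVec : ∀ {k} → (ℕ → Set) → Vec ℚ k → Set
OVec V = All (InO V)

record PrimeListing (p : ℕ → ℕ) : Set where
  field
    all-prime : ∀ i → Prime (p i)
    inj       : ∀ i j → p i ≡ p j → i ≡ j
    surj      : ∀ r → Prime r → Σ ℕ λ i → p i ≡ r

-- 𝒜ᵢ embeds into B by some σ with (τ⁻¹ ∘ σ)|_A = id, i.e. σ|_A = τ|_A
EmbOver : Str → Str → (ℕ → ℕ) → Str → Set
EmbOver Ai B τ A = Σ (ℕ → ℕ) λ σ → Embedding Ai B σ × (∀ a → a ∈D A → σ a ≡ τ a)

EmbId : Str → Str → Str → Set
EmbId Ai AX A = Σ (ℕ → ℕ) λ σ → Embedding Ai AX σ × (∀ a → a ∈D A → σ a ≡ a)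

record Richter (C : Str → Set) (As : ℕ → Str) (A : Str) (AX : (ℕ → Bool) → Str) : Set₁ where
  field
    closedIso  : ∀ S T τ → Iso S T τ → C S → C T
    seqC       : ∀ i → C (As i)
    seqComp    : Σ (Code 2) λ c → ∀ i n → Eval ∅ c (i ∷ n ∷ []) (b2n (diag (As i) n))
    A-C        : C A
    A-fg       : FinitelyGenerated A
    A-sub      : ∀ i → A ⊂ As i
    AX-C       : ∀ X → C (AX X)
    AX-sub     : ∀ X → A ⊂ AX X
    AX-T       : ∀ X → diag (AX X) ≤T X
    AX-emb     : ∀ X i → (EmbId (As i) (AX X) A → X i ≡ true) × (X i ≡ true → EmbId (As i) (AX X) A)
    decide     : ∀ X B τ → Iso (AX X) B τ →
                 Σ (Code 2) λ c → ∀ i j →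
                   (EmbOver (As i) B τ A × ¬ EmbOver (As j) B τ A → Eval (diag B) c (i ∷ j ∷ []) 0) ×
                   (EmbOver (As j) B τ A × ¬ EmbOver (As i) B τ A → Eval (diag B) c (i ∷ j ∷ []) 1)

-- Elements of (O_{ℚ,V})^k are coded by natural numbers in such a way that membership and addition are
-- decided by a program that consults X only on questions "is p_i ∈ V_X?", so 𝒜_X ≤_T X uniformly in X.
-- All embedding conditions reduce to one arithmetic fact: (O_{ℚ,V})^k contains an element whose p-th
-- multiple is e₁ = (1, 0, …, 0) iff p ∈ V, and (1/p_i) e₁ is such an element of 𝒜_i. Hence 𝒜_i embeds
-- over ℤ^k into a copy ℬ of 𝒜_X iff τ(e₁) is divisible by p_i in ℬ. Given the diagram of ℬ, search for
-- the least pair (t, y) with p_i y = τ(e₁) (t = 0) or p_j y = τ(e₁) (t = 1) and answer t: when exactly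
-- one of 𝒜_i, 𝒜_j embeds, only its equation is solvable.

module Submission where

open import Defs
open import Data.Nat using (ℕ; _≤_)
open import Data.Bool using (Bool; true)
open import Data.Product using (Σ; _×_)
open import Data.Rational using (ℚ)
open import Data.Vec using (Vec)
open import Relation.Binary.PropositionalEquality using (_≡_)

open import Data.Nat
open import Data.Nat.Properties
open import Data.Bool using (false; _∧_; _∨_; not; if_then_else_; T)
open import Data.Bool.Properties using (∨-identityʳ)
open import Data.Fin using (Fin; zero; suc; _↑ˡ_; _↑ʳ_)
open import Data.Vec using ([]; _∷_; _++_; lookup; tabulate; head; tail)
open import Data.Vec.Relation.Unary.All using (All; []; _∷_)
import Data.Vec.Relation.Unary.All as All
import Data.Vec as Vec
open import Data.Vec.Properties using (lookup-++ˡ; lookup-++ʳ; tabulate∘lookup; ∷-injective)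
open import Data.Product using (_,_; proj₁; proj₂)
open import Data.Sum using (_⊎_; inj₁; inj₂; [_,_]′)
open import Data.Empty using (⊥; ⊥-elim)
open import Data.Unit using (tt)
open import Relation.Binary.PropositionalEquality
open import Relation.Nullary using (¬_; yes; no)
open import Relation.Nullary.Decidable using (recompute)
open import Data.Nat.Divisibility using (_∣_; divides; ∣⇒≤; ∣-trans; ∣1⇒≡1; m∣m*n; 0∣⇒≡0; hasNonTrivialDivisor)
open import Data.Nat.Primality
open import Data.Nat.Coprimality using (Coprime; coprime?)
open import Data.Integer as ℤ using (ℤ; +_; -[1+_])
open import Data.Rational as ℚ using (mkℚ; 0ℚ; 1ℚ; ↥_; ↧_; ↧ₙ_; toℚᵘ)
import Data.Integer.Properties as ℤ
import Data.Rational.Properties as ℚ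
import Data.Rational.Unnormalised as ℚᵘ
import Data.Rational.Unnormalised.Properties as ℚᵘ
open import Data.Integer.Tactic.RingSolver using (solve-∀)
open import Data.Nat.GCD using (gcd)
import Data.Nat.Coprimality as Coprimality

module BoolFacts where

  true≢false : true ≢ false
  true≢false ()

  T⇒≡true : ∀ {b} → T b → b ≡ true
  T⇒≡true {true} _ = refl

  ≡true⇒T : ∀ {b} → b ≡ true → T b
  ≡true⇒T refl = tt

  ∧-elimˡ : ∀ {a b} → a ∧ b ≡ true → a ≡ true
  ∧-elimˡ {true} _ = refl

  ∧-elimʳ : ∀ {a b} → a ∧ b ≡ true → b ≡ true
  ∧-elimʳ {true} e = e

  ∧-intro : ∀ {a b} → a ≡ true → b ≡ true → a ∧ b ≡ true
  ∧-intro refl refl = refl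

  ∨-elim : ∀ {a b} → a ∨ b ≡ true → a ≡ true ⊎ b ≡ true
  ∨-elim {true} _ = inj₁ refl
  ∨-elim {false} e = inj₂ e

  ∨-introˡ : ∀ {a b} → a ≡ true → a ∨ b ≡ true
  ∨-introˡ refl = refl

  ∨-introʳ : ∀ {a b} → b ≡ true → a ∨ b ≡ true
  ∨-introʳ {true} _ = refl
  ∨-introʳ {false} e = e

  not-elim : ∀ {a} → not a ≡ true → a ≡ false
  not-elim {false} _ = refl

  not-intro : ∀ {a} → a ≡ false → not a ≡ true
  not-intro refl = refl

  false-or-true : ∀ b → b ≡ false ⊎ b ≡ true
  false-or-true false = inj₁ refl
  false-or-true true = inj₂ refl

  ≡true-ext : ∀ {a b} → (a ≡ true → b ≡ true) → (b ≡ true → a ≡ true) → a ≡ b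
  ≡true-ext {false} {false} f g = refl
  ≡true-ext {false} {true} f g = g refl
  ≡true-ext {true} f g = sym (f refl)

  ≤ᵇ⇒≤′ : ∀ {m n} → (m ≤ᵇ n) ≡ true → m ≤ n
  ≤ᵇ⇒≤′ {m} {n} e = ≤ᵇ⇒≤ m n (≡true⇒T e)

  ≤⇒≤ᵇ′ : ∀ {m n} → m ≤ n → (m ≤ᵇ n) ≡ true
  ≤⇒≤ᵇ′ h = T⇒≡true (≤⇒≤ᵇ h)

  ≡ᵇ⇒≡′ : ∀ {m n} → (m ≡ᵇ n) ≡ true → m ≡ n
  ≡ᵇ⇒≡′ {m} {n} e = ≡ᵇ⇒≡ m n (≡true⇒T e)

  ≡⇒≡ᵇ′ : ∀ {m n} → m ≡ n → (m ≡ᵇ n) ≡ true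
  ≡⇒≡ᵇ′ {m} {n} h = T⇒≡true (≡⇒≡ᵇ m n h)

  b2n-∧ : ∀ a b → b2n a * b2n b ≡ b2n (a ∧ b)
  b2n-∧ false b = refl
  b2n-∧ true false = refl
  b2n-∧ true true = refl

open BoolFacts

module BoundedQuantifiers where

  all< : ℕ → (ℕ → Bool) → Bool
  all< zero f = true
  all< (suc q) f = all< q f ∧ f q

  any< : ℕ → (ℕ → Bool) → Bool
  any< zero f = false
  any< (suc q) f = any< q f ∨ f q

  all<-elim : ∀ {n f} → all< n f ≡ true → ∀ q → q < n → f q ≡ true
  all<-elim {suc n} e q q<n with m≤n⇒m<n∨m≡n (s≤s⁻¹ q<n)
  ... | inj₁ lt = all<-elim {n} (∧-elimˡ e) q lt
  ... | inj₂ refl = ∧-elimʳ {all< n _} e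

  all<-intro : ∀ {n f} → (∀ q → q < n → f q ≡ true) → all< n f ≡ true
  all<-intro {zero} h = refl
  all<-intro {suc n} h = ∧-intro (all<-intro (λ q lt → h q (m≤n⇒m≤1+n lt))) (h n ≤-refl)

  any<-elim : ∀ {n f} → any< n f ≡ true → Σ ℕ λ q → q < n × f q ≡ true
  any<-elim {suc n} e with ∨-elim {any< n _} e
  ... | inj₁ e′ = let (q , lt , fq) = any<-elim {n} e′ in q , m≤n⇒m≤1+n lt , fq
  ... | inj₂ e′ = n , ≤-refl , e′

  any<-intro : ∀ {n f} q → q < n → f q ≡ true → any< n f ≡ true
  any<-intro {suc n} q q<n fq with m≤n⇒m<n∨m≡n (s≤s⁻¹ q<n)
  ... | inj₁ lt = ∨-introˡ (any<-intro {n} q lt fq)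
  ... | inj₂ refl = ∨-introʳ {any< n _} fq

open BoundedQuantifiers

module Pairing where

  triangle : ℕ → ℕ
  triangle zero = 0
  triangle (suc s) = suc (s + triangle s)

  pair : ℕ → ℕ → ℕ
  pair a b = triangle (a + b) + b

  -- The diagonal a + b of the pair coded by n, by primitive recursion (so that unpairing is computable).
  diagonal : ℕ → ℕ
  diagonal zero = 0
  diagonal (suc n) = if triangle (suc (diagonal n)) ≤ᵇ suc n then suc (diagonal n) else diagonal n

  unpair₂ : ℕ → ℕ
  unpair₂ n = n ∸ triangle (diagonal n)

  unpair₁ : ℕ → ℕ
  unpair₁ n = diagonal n ∸ unpair₂ n

  private
    diagonal-next : ∀ n → triangle (suc (diagonal n)) ≤ suc n → diagonal (suc n) ≡ suc (diagonal n)
    diagonal-next n h with triangle (suc (diagonal n)) ≤ᵇ suc n in eq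
    ... | true = refl
    ... | false = ⊥-elim (subst T eq (≤⇒≤ᵇ h))

    diagonal-same : ∀ n → ¬ (triangle (suc (diagonal n)) ≤ suc n) → diagonal (suc n) ≡ diagonal n
    diagonal-same n h with triangle (suc (diagonal n)) ≤ᵇ suc n in eq
    ... | true = ⊥-elim (h (≤ᵇ⇒≤′ eq))
    ... | false = refl

    diagonal-invariant : ∀ n → let (a , b) = unpair n in diagonal n ≡ a + b × n ≡ pair a b
    diagonal-invariant zero = refl , refl
    diagonal-invariant (suc n) with unpair n | diagonal-invariant n
    ... | zero , b | d≡b , n≡ = trans (diagonal-next n le) (cong suc (trans d≡b (sym (+-identityʳ b)))) , sn≡
      where
      sn≡tri : suc n ≡ triangle (suc b)
      sn≡tri = cong suc (trans n≡ (+-comm (triangle b) b))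
      le : triangle (suc (diagonal n)) ≤ suc n
      le rewrite d≡b = ≤-reflexive (sym sn≡tri)
      sn≡ : suc n ≡ pair (suc b) 0
      sn≡ = trans sn≡tri (trans (cong triangle (sym (+-identityʳ (suc b)))) (sym (+-identityʳ _)))
    ... | suc a , b | d≡ , n≡ = trans (diagonal-same n next-diagonal-too-far) (trans d≡ (sym (+-suc a b))) , sn≡
      where
      sn≡ : suc n ≡ pair a (suc b)
      sn≡ = trans (cong suc n≡) (trans (cong (λ t → suc (triangle t + b)) (sym (+-suc a b)))
              (sym (+-suc (triangle (a + suc b)) b)))
      next-diagonal-too-far : ¬ (triangle (suc (diagonal n)) ≤ suc n)
      next-diagonal-too-far q = <⇒≱ big (subst₂ _≤_ (cong (λ t → triangle (suc t)) d≡) (cong suc n≡) q)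
        where
        big : suc (triangle (suc a + b) + b) < triangle (suc (suc a + b))
        big = s≤s (subst (suc (triangle (suc a + b) + b) ≤_) (+-comm (triangle (suc a + b)) (suc a + b))
                (+-monoʳ-< (triangle (suc a + b)) (s≤s (m≤n+m b a))))

  unpair≡ : ∀ n → unpair n ≡ (unpair₁ n , unpair₂ n)
  unpair≡ n with unpair n | diagonal-invariant n
  ... | a , b | d≡ , n≡ = cong₂ _,_ (sym a≡) (sym b≡)
    where
    b≡ : unpair₂ n ≡ b
    b≡ = trans (cong (λ t → n ∸ triangle t) d≡) (trans (cong (_∸ triangle (a + b)) n≡) (m+n∸m≡n (triangle (a + b)) b))
    a≡ : unpair₁ n ≡ a
    a≡ = trans (cong₂ _∸_ d≡ b≡) (m+n∸n≡m a b)

  private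
    pair-suc-b : ∀ a b → pair a (suc b) ≡ suc (pair (suc a) b)
    pair-suc-b a b = trans (cong (λ t → triangle t + suc b) (+-suc a b)) (+-suc (triangle (suc (a + b))) b)

    pair-suc-a : ∀ s → pair (suc s) 0 ≡ suc (pair 0 s)
    pair-suc-a s = trans (+-identityʳ _) (trans (cong triangle (+-identityʳ (suc s))) (cong suc (+-comm s (triangle s))))

    unpair-suc-zero : ∀ m b → unpair m ≡ (0 , b) → unpair (suc m) ≡ (suc b , 0)
    unpair-suc-zero m b e rewrite e = refl

    unpair-suc-suc : ∀ m a b → unpair m ≡ (suc a , b) → unpair (suc m) ≡ (a , suc b)
    unpair-suc-suc m a b e rewrite e = refl

    unpair-pair-on : ∀ s a b → a + b ≡ s → unpair (pair a b) ≡ (a , b)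
    unpair-pair-on s zero zero e = refl
    unpair-pair-on s a (suc b) e = trans (cong unpair (pair-suc-b a b))
      (unpair-suc-suc (pair (suc a) b) a b (unpair-pair-on s (suc a) b (trans (sym (+-suc a b)) e)))
    unpair-pair-on (suc s) (suc a) zero e = trans (cong unpair (pair-suc-a a))
      (unpair-suc-zero (pair 0 a) a (unpair-pair-on s zero a (suc-injective (trans (sym (+-identityʳ (suc a))) e))))

  unpair-pair : ∀ a b → unpair (pair a b) ≡ (a , b)
  unpair-pair a b = unpair-pair-on (a + b) a b refl

  unpair₁-pair : ∀ a b → unpair₁ (pair a b) ≡ a
  unpair₁-pair a b = cong proj₁ (trans (sym (unpair≡ (pair a b))) (unpair-pair a b))

  unpair₂-pair : ∀ a b → unpair₂ (pair a b) ≡ b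
  unpair₂-pair a b = cong proj₂ (trans (sym (unpair≡ (pair a b))) (unpair-pair a b))

  pair-unpair : ∀ n → pair (unpair₁ n) (unpair₂ n) ≡ n
  pair-unpair n = trans (cong (λ u → pair (proj₁ u) (proj₂ u)) (sym (unpair≡ n))) (sym (proj₂ (diagonal-invariant n)))

  triple : ℕ → ℕ → ℕ → ℕ
  triple a b c = pair a (pair b c)

  uncurry₃ : {A : Set} → (ℕ → ℕ → ℕ → A) → ℕ → A
  uncurry₃ f n = f (unpair₁ n) (unpair₁ (unpair₂ n)) (unpair₂ (unpair₂ n))

  uncurry₃-triple : {A : Set} (f : ℕ → ℕ → ℕ → A) → ∀ a b c → uncurry₃ f (triple a b c) ≡ f a b c
  uncurry₃-triple f a b c rewrite unpair₁-pair a (pair b c) | unpair₂-pair a (pair b c)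
                                | unpair₁-pair b c | unpair₂-pair b c = refl

  triple-unpair : ∀ n → uncurry₃ triple n ≡ n
  triple-unpair n = trans (cong (pair (unpair₁ n)) (pair-unpair (unpair₂ n))) (pair-unpair n)

open Pairing

module BasicCodes where

  constC : ∀ {n} → ℕ → Code n
  constC zero = zeroC
  constC (suc k) = compC succC (constC k ∷ [])

  π₀ : ∀ {n} → Code (suc n)
  π₀ = projC zero

  π₁ : ∀ {n} → Code (suc (suc n))
  π₁ = projC (suc zero)

  π₂ : ∀ {n} → Code (suc (suc (suc n)))
  π₂ = projC (suc (suc zero))

  addC : Code 2
  addC = recC π₀ (compC succC (π₁ ∷ []))

  mulC : Code 2
  mulC = recC zeroC (compC addC (π₂ ∷ π₁ ∷ []))

  predC : Code 1
  predC = recC zeroC π₀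

  -- Truncated subtraction with its arguments swapped, so that recursion runs on the subtrahend.
  flippedMonusC : Code 2
  flippedMonusC = recC π₀ (compC predC (π₁ ∷ []))

  monusC : Code 2
  monusC = compC flippedMonusC (π₁ ∷ π₀ ∷ [])

  isZeroC : Code 1
  isZeroC = recC (constC 1) zeroC

  leC : Code 2
  leC = compC isZeroC (monusC ∷ [])

  andC : Code 2
  andC = mulC

  notC : Code 1
  notC = isZeroC

  orC : Code 2
  orC = compC notC (compC andC (compC notC (π₀ ∷ []) ∷ compC notC (π₁ ∷ []) ∷ []) ∷ [])

  eqC : Code 2
  eqC = compC andC (leC ∷ compC leC (π₁ ∷ π₀ ∷ []) ∷ [])

  ifC : Code 3
  ifC = recC π₁ π₂

  triangleC : Code 1
  triangleC = recC zeroC (compC succC (compC addC (π₀ ∷ π₁ ∷ []) ∷ []))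

  pairC : Code 2
  pairC = compC addC (compC triangleC (addC ∷ []) ∷ π₁ ∷ [])

  diagonalC : Code 1
  diagonalC = recC zeroC (compC ifC (compC leC (compC triangleC (compC succC (π₁ ∷ []) ∷ []) ∷ compC succC (π₀ ∷ []) ∷ [])
                           ∷ compC succC (π₁ ∷ []) ∷ π₁ ∷ []))

  unpair₂C : Code 1
  unpair₂C = compC monusC (π₀ ∷ compC triangleC (diagonalC ∷ []) ∷ [])

  unpair₁C : Code 1
  unpair₁C = compC monusC (diagonalC ∷ unpair₂C ∷ [])

  private
    suc≤ᵇsuc : ∀ x y → (suc x ≤ᵇ suc y) ≡ (x ≤ᵇ y)
    suc≤ᵇsuc zero y = refl
    suc≤ᵇsuc (suc x) y = refl

    ≤ᵇ≡∸≡ᵇ0 : ∀ x y → (x ≤ᵇ y) ≡ (x ∸ y ≡ᵇ 0)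
    ≤ᵇ≡∸≡ᵇ0 zero y rewrite 0∸n≡0 y = refl
    ≤ᵇ≡∸≡ᵇ0 (suc x) zero = refl
    ≤ᵇ≡∸≡ᵇ0 (suc x) (suc y) = trans (suc≤ᵇsuc x y) (≤ᵇ≡∸≡ᵇ0 x y)
    ≡ᵇ-antisym : ∀ x y → (x ≡ᵇ y) ≡ ((x ≤ᵇ y) ∧ (y ≤ᵇ x))
    ≡ᵇ-antisym zero zero = refl
    ≡ᵇ-antisym zero (suc y) = refl
    ≡ᵇ-antisym (suc x) zero = refl
    ≡ᵇ-antisym (suc x) (suc y) = trans (≡ᵇ-antisym x y) (cong₂ _∧_ (sym (suc≤ᵇsuc x y)) (sym (suc≤ᵇsuc y x)))
    not∧not : ∀ a b → not (not a ∧ not b) ≡ (a ∨ b)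
    not∧not false false = refl
    not∧not false true = refl
    not∧not true b = refl

  module _ {O : ℕ → Bool} where

    eval-const : ∀ {n} k (xs : Vec ℕ n) → Eval O (constC k) xs k
    eval-const zero xs = ev-zero
    eval-const (suc k) xs = ev-comp (eval-const k xs ∷ []) ev-succ

    ev-comp₁ : ∀ {n} {f : Code 1} {g : Code n} {xs y z} →
               Eval O g xs y → Eval O f (y ∷ []) z → Eval O (compC f (g ∷ [])) xs z
    ev-comp₁ e₁ e = ev-comp (e₁ ∷ []) e

    ev-comp₂ : ∀ {n} {f : Code 2} {g h : Code n} {xs y y′ z} →
               Eval O g xs y → Eval O h xs y′ → Eval O f (y ∷ y′ ∷ []) z → Eval O (compC f (g ∷ h ∷ [])) xs z
    ev-comp₂ e₁ e₂ e = ev-comp (e₁ ∷ e₂ ∷ []) e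

    ev-comp₃ : ∀ {n} {f : Code 3} {g h i : Code n} {xs y y′ y″ z} →
               Eval O g xs y → Eval O h xs y′ → Eval O i xs y″ → Eval O f (y ∷ y′ ∷ y″ ∷ []) z →
               Eval O (compC f (g ∷ h ∷ i ∷ [])) xs z
    ev-comp₃ e₁ e₂ e₃ e = ev-comp (e₁ ∷ e₂ ∷ e₃ ∷ []) e

    eval-add : ∀ x y → Eval O addC (x ∷ y ∷ []) (x + y)
    eval-add zero y = ev-rec0 ev-proj
    eval-add (suc x) y = ev-recS (eval-add x y) (ev-comp₁ ev-proj ev-succ)

    eval-mul : ∀ x y → Eval O mulC (x ∷ y ∷ []) (x * y)
    eval-mul zero y = ev-rec0 ev-zero
    eval-mul (suc x) y = ev-recS (eval-mul x y) (ev-comp₂ ev-proj ev-proj (eval-add y (x * y)))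

    eval-pred : ∀ x → Eval O predC (x ∷ []) (pred x)
    eval-pred zero = ev-rec0 ev-zero
    eval-pred (suc x) = ev-recS (eval-pred x) ev-proj

    eval-flippedMonus : ∀ y x → Eval O flippedMonusC (y ∷ x ∷ []) (x ∸ y)
    eval-flippedMonus zero x = ev-rec0 ev-proj
    eval-flippedMonus (suc y) x = subst (Eval O flippedMonusC (suc y ∷ x ∷ [])) (pred[m∸n]≡m∸[1+n] x y)
      (ev-recS (eval-flippedMonus y x) (ev-comp₁ ev-proj (eval-pred (x ∸ y))))

    eval-monus : ∀ x y → Eval O monusC (x ∷ y ∷ []) (x ∸ y)
    eval-monus x y = ev-comp₂ ev-proj ev-proj (eval-flippedMonus y x)

    eval-isZero : ∀ x → Eval O isZeroC (x ∷ []) (b2n (x ≡ᵇ 0))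
    eval-isZero zero = ev-rec0 (eval-const 1 [])
    eval-isZero (suc x) = ev-recS (eval-isZero x) ev-zero

    eval-le : ∀ x y → Eval O leC (x ∷ y ∷ []) (b2n (x ≤ᵇ y))
    eval-le x y rewrite ≤ᵇ≡∸≡ᵇ0 x y = ev-comp₁ (eval-monus x y) (eval-isZero (x ∸ y))

    eval-and : ∀ a b → Eval O andC (b2n a ∷ b2n b ∷ []) (b2n (a ∧ b))
    eval-and a b rewrite sym (b2n-∧ a b) = eval-mul (b2n a) (b2n b)

    eval-not : ∀ a → Eval O notC (b2n a ∷ []) (b2n (not a))
    eval-not false = eval-isZero 0
    eval-not true = eval-isZero 1

    eval-or : ∀ a b → Eval O orC (b2n a ∷ b2n b ∷ []) (b2n (a ∨ b))
    eval-or a b = subst (Eval O orC (b2n a ∷ b2n b ∷ [])) (cong b2n (not∧not a b))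
      (ev-comp₁ (ev-comp₂ (ev-comp₁ ev-proj (eval-not a)) (ev-comp₁ ev-proj (eval-not b)) (eval-and (not a) (not b)))
                (eval-not (not a ∧ not b)))

    eval-eq : ∀ x y → Eval O eqC (x ∷ y ∷ []) (b2n (x ≡ᵇ y))
    eval-eq x y rewrite ≡ᵇ-antisym x y =
      ev-comp₂ (eval-le x y) (ev-comp₂ ev-proj ev-proj (eval-le y x)) (eval-and (x ≤ᵇ y) (y ≤ᵇ x))

    eval-if : ∀ (b : Bool) x y → Eval O ifC (b2n b ∷ x ∷ y ∷ []) (if b then x else y)
    eval-if false x y = ev-rec0 ev-proj
    eval-if true x y = ev-recS (ev-rec0 ev-proj) ev-proj

    eval-triangle : ∀ s → Eval O triangleC (s ∷ []) (triangle s)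
    eval-triangle zero = ev-rec0 ev-zero
    eval-triangle (suc s) = ev-recS (eval-triangle s) (ev-comp₁ (ev-comp₂ ev-proj ev-proj (eval-add s (triangle s))) ev-succ)

    eval-pair : ∀ a b → Eval O pairC (a ∷ b ∷ []) (pair a b)
    eval-pair a b = ev-comp₂ (ev-comp₁ (eval-add a b) (eval-triangle (a + b))) ev-proj (eval-add (triangle (a + b)) b)

    eval-diagonal : ∀ n → Eval O diagonalC (n ∷ []) (diagonal n)
    eval-diagonal zero = ev-rec0 ev-zero
    eval-diagonal (suc n) = ev-recS (eval-diagonal n)
      (ev-comp₃ (ev-comp₂ (ev-comp₁ (ev-comp₁ ev-proj ev-succ) (eval-triangle (suc (diagonal n))))
                          (ev-comp₁ ev-proj ev-succ) (eval-le (triangle (suc (diagonal n))) (suc n)))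
                (ev-comp₁ ev-proj ev-succ) ev-proj
                (eval-if (triangle (suc (diagonal n)) ≤ᵇ suc n) (suc (diagonal n)) (diagonal n)))

    eval-unpair₂ : ∀ n → Eval O unpair₂C (n ∷ []) (unpair₂ n)
    eval-unpair₂ n = ev-comp₂ ev-proj (ev-comp₁ (eval-diagonal n) (eval-triangle (diagonal n))) (eval-monus n (triangle (diagonal n)))

    eval-unpair₁ : ∀ n → Eval O unpair₁C (n ∷ []) (unpair₁ n)
    eval-unpair₁ n = ev-comp₂ (eval-diagonal n) (eval-unpair₂ n) (eval-monus (diagonal n) (unpair₂ n))

open BasicCodes

-- Expressions over ℕ with extra operations given by a signature, compiled soundly into Code for any
-- implementation of the operations by codes; all computable predicates below are written this way.
module Expressions where

  record Signature : Set where
    field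
      numOps boolOps : ℕ
      numArity : Fin numOps → ℕ
      boolArity : Fin boolOps → ℕ
  open Signature public

  iterate : ℕ → (ℕ → ℕ → ℕ) → ℕ → ℕ
  iterate z s zero = z
  iterate z s (suc q) = s q (iterate z s q)

  module Syntax (S : Signature) where
    mutual
      data NExp (n : ℕ) : Set where
        var : Fin n → NExp n
        lit : ℕ → NExp n
        add mul monus pairN : NExp n → NExp n → NExp n
        unpair₁N unpair₂N : NExp n → NExp n
        ifN : BExp n → NExp n → NExp n → NExp n
        iterN : NExp n → NExp n → NExp (suc (suc n)) → NExp n
        letN : ∀ {j} → Vec (NExp n) j → NExp j → NExp n
        opN : (i : Fin (numOps S)) → Vec (NExp n) (numArity S i) → NExp n
      data BExp (n : ℕ) : Set where
        tt : BExp n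
        eqB leB : NExp n → NExp n → BExp n
        andB orB : BExp n → BExp n → BExp n
        notB : BExp n → BExp n
        allB anyB : NExp n → BExp (suc n) → BExp n
        letB : ∀ {j} → Vec (NExp n) j → BExp j → BExp n
        opB : (i : Fin (boolOps S)) → Vec (NExp n) (boolArity S i) → BExp n

    v₀ : ∀ {n} → NExp (suc n)
    v₀ = var zero
    v₁ : ∀ {n} → NExp (suc (suc n))
    v₁ = var (suc zero)
    v₂ : ∀ {n} → NExp (suc (suc (suc n)))
    v₂ = var (suc (suc zero))
    v₃ : ∀ {n} → NExp (suc (suc (suc (suc n))))
    v₃ = var (suc (suc (suc zero)))

    record Interpretation : Set where
      field
        numOp : (i : Fin (numOps S)) → Vec ℕ (numArity S i) → ℕ
        boolOp : (i : Fin (boolOps S)) → Vec ℕ (boolArity S i) → Bool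
    open Interpretation public

    module Semantics (I : Interpretation) where
      mutual
        ⟦_⟧ : ∀ {n} → NExp n → Vec ℕ n → ℕ
        ⟦ var i ⟧ xs = lookup xs i
        ⟦ lit k ⟧ xs = k
        ⟦ add a b ⟧ xs = ⟦ a ⟧ xs + ⟦ b ⟧ xs
        ⟦ mul a b ⟧ xs = ⟦ a ⟧ xs * ⟦ b ⟧ xs
        ⟦ monus a b ⟧ xs = ⟦ a ⟧ xs ∸ ⟦ b ⟧ xs
        ⟦ pairN a b ⟧ xs = pair (⟦ a ⟧ xs) (⟦ b ⟧ xs)
        ⟦ unpair₁N a ⟧ xs = unpair₁ (⟦ a ⟧ xs)
        ⟦ unpair₂N a ⟧ xs = unpair₂ (⟦ a ⟧ xs)
        ⟦ ifN b x y ⟧ xs = if ⟦ b ⟧ᴮ xs then ⟦ x ⟧ xs else ⟦ y ⟧ xs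
        ⟦ iterN b z s ⟧ xs = iterate (⟦ z ⟧ xs) (λ q a → ⟦ s ⟧ (q ∷ a ∷ xs)) (⟦ b ⟧ xs)
        ⟦ letN es e ⟧ xs = ⟦ e ⟧ (⟦ es ⟧* xs)
        ⟦ opN i es ⟧ xs = numOp I i (⟦ es ⟧* xs)

        ⟦_⟧* : ∀ {n j} → Vec (NExp n) j → Vec ℕ n → Vec ℕ j
        ⟦ [] ⟧* xs = []
        ⟦ e ∷ es ⟧* xs = ⟦ e ⟧ xs ∷ ⟦ es ⟧* xs

        ⟦_⟧ᴮ : ∀ {n} → BExp n → Vec ℕ n → Bool
        ⟦ tt ⟧ᴮ xs = true
        ⟦ eqB a b ⟧ᴮ xs = ⟦ a ⟧ xs ≡ᵇ ⟦ b ⟧ xs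
        ⟦ leB a b ⟧ᴮ xs = ⟦ a ⟧ xs ≤ᵇ ⟦ b ⟧ xs
        ⟦ andB a b ⟧ᴮ xs = ⟦ a ⟧ᴮ xs ∧ ⟦ b ⟧ᴮ xs
        ⟦ orB a b ⟧ᴮ xs = ⟦ a ⟧ᴮ xs ∨ ⟦ b ⟧ᴮ xs
        ⟦ notB a ⟧ᴮ xs = not (⟦ a ⟧ᴮ xs)
        ⟦ allB b body ⟧ᴮ xs = all< (⟦ b ⟧ xs) (λ q → ⟦ body ⟧ᴮ (q ∷ xs))
        ⟦ anyB b body ⟧ᴮ xs = any< (⟦ b ⟧ xs) (λ q → ⟦ body ⟧ᴮ (q ∷ xs))
        ⟦ letB es e ⟧ᴮ xs = ⟦ e ⟧ᴮ (⟦ es ⟧* xs)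
        ⟦ opB i es ⟧ᴮ xs = boolOp I i (⟦ es ⟧* xs)

    identityArgs : ∀ {k} → Vec (Code k) k
    identityArgs = tabulate projC

    dropTwoArgs : ∀ {k} → Vec (Code (suc (suc k))) k
    dropTwoArgs = tabulate (λ j → projC (suc (suc j)))

    -- Compiled expressions in n variables take m further parameters, passed on to the operation codes.
    module Compile (m : ℕ) (numOpC : (i : Fin (numOps S)) → Code (numArity S i + m))
                           (boolOpC : (i : Fin (boolOps S)) → Code (boolArity S i + m)) where
      parameters : ∀ n → Vec (Code (n + m)) m
      parameters n = tabulate (λ j → projC (n ↑ʳ j))

      mutual
        compile : ∀ {n} → NExp n → Code (n + m)
        compile (var i) = projC (i ↑ˡ m)
        compile (lit k) = constC k
        compile (add a b) = compC addC (compile a ∷ compile b ∷ [])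
        compile (mul a b) = compC mulC (compile a ∷ compile b ∷ [])
        compile (monus a b) = compC monusC (compile a ∷ compile b ∷ [])
        compile (pairN a b) = compC pairC (compile a ∷ compile b ∷ [])
        compile (unpair₁N a) = compC unpair₁C (compile a ∷ [])
        compile (unpair₂N a) = compC unpair₂C (compile a ∷ [])
        compile (ifN b x y) = compC ifC (compileᴮ b ∷ compile x ∷ compile y ∷ [])
        compile (iterN b z s) = compC (recC (compile z) (compile s)) (compile b ∷ identityArgs)
        compile {n} (letN es e) = compC (compile e) (compile* es ++ parameters n)
        compile {n} (opN i es) = compC (numOpC i) (compile* es ++ parameters n)

        compile* : ∀ {n j} → Vec (NExp n) j → Vec (Code (n + m)) j
        compile* [] = []
        compile* (e ∷ es) = compile e ∷ compile* es

        compileᴮ : ∀ {n} → BExp n → Code (n + m)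
        compileᴮ tt = constC 1
        compileᴮ (eqB a b) = compC eqC (compile a ∷ compile b ∷ [])
        compileᴮ (leB a b) = compC leC (compile a ∷ compile b ∷ [])
        compileᴮ (andB a b) = compC andC (compileᴮ a ∷ compileᴮ b ∷ [])
        compileᴮ (orB a b) = compC orC (compileᴮ a ∷ compileᴮ b ∷ [])
        compileᴮ (notB a) = compC notC (compileᴮ a ∷ [])
        compileᴮ (allB b body) = compC (recC (constC 1) (compC andC (π₁ ∷ compC (compileᴮ body) (π₀ ∷ dropTwoArgs) ∷ [])))
                                       (compile b ∷ identityArgs)
        compileᴮ (anyB b body) = compC (recC (constC 0) (compC orC (π₁ ∷ compC (compileᴮ body) (π₀ ∷ dropTwoArgs) ∷ [])))
                                       (compile b ∷ identityArgs)
        compileᴮ {n} (letB es e) = compC (compileᴮ e) (compile* es ++ parameters n)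
        compileᴮ {n} (opB i es) = compC (boolOpC i) (compile* es ++ parameters n)

  private
    evalAll-tabulate : ∀ {O k j} {f : Fin j → Code k} {g : Fin j → ℕ} {env} →
                       (∀ i → Eval O (f i) env (g i)) → EvalAll O (tabulate f) env (tabulate g)
    evalAll-tabulate {j = zero} h = []
    evalAll-tabulate {j = suc j} h = h zero ∷ evalAll-tabulate (λ i → h (suc i))

    evalAll-++ : ∀ {O k a b} {gs : Vec (Code k) a} {hs : Vec (Code k) b} {env vs ws} →
                 EvalAll O gs env vs → EvalAll O hs env ws → EvalAll O (gs ++ hs) env (vs ++ ws)
    evalAll-++ [] h = h
    evalAll-++ (e ∷ es) h = e ∷ evalAll-++ es h

    evalAll-tabulate-lookup : ∀ {O k j} {f : Fin j → Code k} {env} (vs : Vec ℕ j) →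
                              (∀ i → Eval O (f i) env (lookup vs i)) → EvalAll O (tabulate f) env vs
    evalAll-tabulate-lookup vs h = subst (EvalAll _ _ _) (tabulate∘lookup vs) (evalAll-tabulate h)

  module Soundness (S : Signature) (O : ℕ → Bool) (m : ℕ) (ys : Vec ℕ m) (I : Syntax.Interpretation S)
    (numOpC : (i : Fin (numOps S)) → Code (numArity S i + m))
    (boolOpC : (i : Fin (boolOps S)) → Code (boolArity S i + m))
    (numOpC-eval : ∀ i v → Eval O (numOpC i) (v ++ ys) (Syntax.numOp I i v))
    (boolOpC-eval : ∀ i v → Eval O (boolOpC i) (v ++ ys) (b2n (Syntax.boolOp I i v))) where
    open Syntax S
    open Semantics I
    open Compile m numOpC boolOpC

    private
      eval-identityArgs : ∀ {k} (env : Vec ℕ k) → EvalAll O identityArgs env env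
      eval-identityArgs env = evalAll-tabulate-lookup env (λ i → ev-proj)

      eval-dropTwoArgs : ∀ {k} a b (env : Vec ℕ k) → EvalAll O dropTwoArgs (a ∷ b ∷ env) env
      eval-dropTwoArgs a b env = evalAll-tabulate-lookup env (λ i → ev-proj)

      eval-parameters : ∀ {n} (xs : Vec ℕ n) → EvalAll O (parameters n) (xs ++ ys) ys
      eval-parameters xs = evalAll-tabulate-lookup ys (λ j → subst (Eval O _ _) (lookup-++ʳ xs ys j) ev-proj)

      eval-rec : ∀ {n} {z : Code n} {s : Code (suc (suc n))} {env} (zv : ℕ) (sf : ℕ → ℕ → ℕ) →
                 Eval O z env zv → (∀ q a → Eval O s (q ∷ a ∷ env) (sf q a)) →
                 ∀ x → Eval O (recC z s) (x ∷ env) (iterate zv sf x)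
      eval-rec zv sf hz hs zero = ev-rec0 hz
      eval-rec zv sf hz hs (suc x) = ev-recS (eval-rec zv sf hz hs x) (hs x (iterate zv sf x))

    mutual
      compile-sound : ∀ {n} (e : NExp n) (xs : Vec ℕ n) → Eval O (compile e) (xs ++ ys) (⟦ e ⟧ xs)
      compile-sound (var i) xs = subst (Eval O (projC (i ↑ˡ m)) (xs ++ ys)) (lookup-++ˡ xs ys i) ev-proj
      compile-sound (lit k) xs = eval-const k _
      compile-sound (add a b) xs = ev-comp₂ (compile-sound a xs) (compile-sound b xs) (eval-add _ _)
      compile-sound (mul a b) xs = ev-comp₂ (compile-sound a xs) (compile-sound b xs) (eval-mul _ _)
      compile-sound (monus a b) xs = ev-comp₂ (compile-sound a xs) (compile-sound b xs) (eval-monus _ _)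
      compile-sound (pairN a b) xs = ev-comp₂ (compile-sound a xs) (compile-sound b xs) (eval-pair _ _)
      compile-sound (unpair₁N a) xs = ev-comp₁ (compile-sound a xs) (eval-unpair₁ _)
      compile-sound (unpair₂N a) xs = ev-comp₁ (compile-sound a xs) (eval-unpair₂ _)
      compile-sound (ifN b x y) xs =
        ev-comp₃ (compileᴮ-sound b xs) (compile-sound x xs) (compile-sound y xs) (eval-if (⟦ b ⟧ᴮ xs) _ _)
      compile-sound (iterN b z s) xs = ev-comp (compile-sound b xs ∷ eval-identityArgs (xs ++ ys))
        (eval-rec (⟦ z ⟧ xs) (λ q a → ⟦ s ⟧ (q ∷ a ∷ xs)) (compile-sound z xs)
                  (λ q a → compile-sound s (q ∷ a ∷ xs)) (⟦ b ⟧ xs))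
      compile-sound (letN es e) xs =
        ev-comp (evalAll-++ (compile*-sound es xs) (eval-parameters xs)) (compile-sound e (⟦ es ⟧* xs))
      compile-sound (opN i es) xs =
        ev-comp (evalAll-++ (compile*-sound es xs) (eval-parameters xs)) (numOpC-eval i (⟦ es ⟧* xs))

      compile*-sound : ∀ {n j} (es : Vec (NExp n) j) (xs : Vec ℕ n) → EvalAll O (compile* es) (xs ++ ys) (⟦ es ⟧* xs)
      compile*-sound [] xs = []
      compile*-sound (e ∷ es) xs = compile-sound e xs ∷ compile*-sound es xs

      compileᴮ-sound : ∀ {n} (e : BExp n) (xs : Vec ℕ n) → Eval O (compileᴮ e) (xs ++ ys) (b2n (⟦ e ⟧ᴮ xs))
      compileᴮ-sound tt xs = eval-const 1 _
      compileᴮ-sound (eqB a b) xs = ev-comp₂ (compile-sound a xs) (compile-sound b xs) (eval-eq _ _)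
      compileᴮ-sound (leB a b) xs = ev-comp₂ (compile-sound a xs) (compile-sound b xs) (eval-le _ _)
      compileᴮ-sound (andB a b) xs = ev-comp₂ (compileᴮ-sound a xs) (compileᴮ-sound b xs) (eval-and _ _)
      compileᴮ-sound (orB a b) xs = ev-comp₂ (compileᴮ-sound a xs) (compileᴮ-sound b xs) (eval-or _ _)
      compileᴮ-sound (notB a) xs = ev-comp₁ (compileᴮ-sound a xs) (eval-not _)
      compileᴮ-sound (allB b body) xs = ev-comp (compile-sound b xs ∷ eval-identityArgs (xs ++ ys)) (loop (⟦ b ⟧ xs))
        where
        f = λ q → ⟦ body ⟧ᴮ (q ∷ xs)
        loop : ∀ x → Eval O (recC (constC 1) (compC andC (π₁ ∷ compC (compileᴮ body) (π₀ ∷ dropTwoArgs) ∷ [])))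
                            (x ∷ xs ++ ys) (b2n (all< x f))
        loop zero = ev-rec0 (eval-const 1 _)
        loop (suc x) = ev-recS (loop x) (ev-comp₂ ev-proj
          (ev-comp (ev-proj ∷ eval-dropTwoArgs _ _ (xs ++ ys)) (compileᴮ-sound body (x ∷ xs))) (eval-and (all< x f) (f x)))
      compileᴮ-sound (anyB b body) xs = ev-comp (compile-sound b xs ∷ eval-identityArgs (xs ++ ys)) (loop (⟦ b ⟧ xs))
        where
        f = λ q → ⟦ body ⟧ᴮ (q ∷ xs)
        loop : ∀ x → Eval O (recC (constC 0) (compC orC (π₁ ∷ compC (compileᴮ body) (π₀ ∷ dropTwoArgs) ∷ [])))
                            (x ∷ xs ++ ys) (b2n (any< x f))
        loop zero = ev-rec0 (eval-const 0 _)
        loop (suc x) = ev-recS (loop x) (ev-comp₂ ev-proj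
          (ev-comp (ev-proj ∷ eval-dropTwoArgs _ _ (xs ++ ys)) (compileᴮ-sound body (x ∷ xs))) (eval-or (any< x f) (f x)))
      compileᴮ-sound (letB es e) xs =
        ev-comp (evalAll-++ (compile*-sound es xs) (eval-parameters xs)) (compileᴮ-sound e (⟦ es ⟧* xs))
      compileᴮ-sound (opB i es) xs =
        ev-comp (evalAll-++ (compile*-sound es xs) (eval-parameters xs)) (boolOpC-eval i (⟦ es ⟧* xs))

open Expressions

module Minimisation where

  Least : (ℕ → Bool) → ℕ → Set
  Least g y = g y ≡ true × (∀ z → z < y → g z ≡ false)

  private
    search : (g : ℕ → Bool) (n : ℕ) → (Σ ℕ λ y → Least g y) ⊎ (∀ z → z < n → g z ≡ false)
    search g zero = inj₂ (λ z ())
    search g (suc n) with search g n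
    ... | inj₁ found = inj₁ found
    ... | inj₂ below with g n in eq
    ...   | true = inj₁ (n , eq , below)
    ...   | false = inj₂ λ z z<sn → [ below z , (λ { refl → eq }) ]′ (m≤n⇒m<n∨m≡n (s≤s⁻¹ z<sn))

  least : (g : ℕ → Bool) (w : ℕ) → g w ≡ true → Σ ℕ (Least g)
  least g w gw with search g w
  ... | inj₁ found = found
  ... | inj₂ below = w , gw , below

  eval-μ : ∀ {O n} {c : Code (suc n)} {xs} (g : ℕ → Bool) → (∀ z → Eval O c (z ∷ xs) (b2n (not (g z)))) →
           ∀ y → Least g y → Eval O (muC c) xs y
  eval-μ {O} {c = c} {xs} g h y (gy , below) = ev-mu (subst (Eval O c (y ∷ xs)) (cong (λ b → b2n (not b)) gy) (h y))
    λ z z<y → 0 , subst (Eval O c (z ∷ xs)) (cong (λ b → b2n (not b)) (below z z<y)) (h z)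

open Minimisation

module Relativisation where

  mutual
    withOracleIgnored : ∀ {n} → Code n → Code n
    withOracleIgnored zeroC = zeroC
    withOracleIgnored succC = succC
    withOracleIgnored (projC i) = projC i
    withOracleIgnored (compC f gs) = compC (withOracleIgnored f) (withOracleIgnored* gs)
    withOracleIgnored (recC f g) = recC (withOracleIgnored f) (withOracleIgnored g)
    withOracleIgnored (muC f) = muC (withOracleIgnored f)
    withOracleIgnored oracleC = zeroC

    withOracleIgnored* : ∀ {n m} → Vec (Code n) m → Vec (Code n) m
    withOracleIgnored* [] = []
    withOracleIgnored* (g ∷ gs) = withOracleIgnored g ∷ withOracleIgnored* gs

  mutual
    relativise : ∀ {O n} {c : Code n} {xs y} → Eval ∅ c xs y → Eval O (withOracleIgnored c) xs y
    relativise ev-zero = ev-zero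
    relativise ev-succ = ev-succ
    relativise ev-proj = ev-proj
    relativise (ev-comp es e) = ev-comp (relativise* es) (relativise e)
    relativise (ev-rec0 e) = ev-rec0 (relativise e)
    relativise (ev-recS e₁ e₂) = ev-recS (relativise e₁) (relativise e₂)
    relativise (ev-mu e below) = ev-mu (relativise e) (λ z lt → proj₁ (below z lt) , relativise (proj₂ (below z lt)))
    relativise ev-orc = ev-zero

    relativise* : ∀ {O n m} {gs : Vec (Code n) m} {xs ys} → EvalAll ∅ gs xs ys → EvalAll O (withOracleIgnored* gs) xs ys
    relativise* [] = []
    relativise* (e ∷ es) = relativise e ∷ relativise* es

open Relativisation

module ArithmeticDecisions where

  dividesᵇ : ℕ → ℕ → Bool
  dividesᵇ r x = any< (suc x) (λ q → (q * r) ≡ᵇ x)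

  dividesᵇ⇒∣ : ∀ {r x} → dividesᵇ r x ≡ true → r ∣ x
  dividesᵇ⇒∣ {r} {x} e = let (q , _ , h) = any<-elim {suc x} e in divides q (sym (≡ᵇ⇒≡′ h))

  ∣⇒dividesᵇ : ∀ {r x} → r ∣ x → dividesᵇ r x ≡ true
  ∣⇒dividesᵇ {zero} {x} (divides q eq) = any<-intro {suc x} 0 (s≤s z≤n) (≡⇒≡ᵇ′ (sym (trans eq (*-zeroʳ q))))
  ∣⇒dividesᵇ {suc r} {x} (divides q eq) =
    any<-intro {suc x} q (s≤s (subst (q ≤_) (sym eq) (m≤m*n q (suc r)))) (≡⇒≡ᵇ′ (sym eq))

  -- Correct only for y ≠ 0: common divisors are searched below y + 1.
  coprimeᵇ : ℕ → ℕ → Bool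
  coprimeᵇ x y = all< (suc y) (λ r → not ((2 ≤ᵇ r) ∧ (dividesᵇ r x ∧ dividesᵇ r y)))

  coprimeᵇ⇒Coprime : ∀ {x d} → coprimeᵇ x (suc d) ≡ true → Coprime x (suc d)
  coprimeᵇ⇒Coprime {x} {d} e {c} (c∣x , c∣y) with c | c∣y
  ... | zero | c∣y′ = ⊥-elim (1+n≢0 (0∣⇒≡0 c∣y′))
  ... | suc zero | _ = refl
  ... | suc (suc c′) | c∣y′ = ⊥-elim (true≢false (trans
          (sym (∧-intro (≤⇒≤ᵇ′ {2} {suc (suc c′)} (s≤s (s≤s z≤n)))
                        (∧-intro (∣⇒dividesᵇ c∣x) (∣⇒dividesᵇ c∣y′))))
          (not-elim (all<-elim {suc (suc d)} e (suc (suc c′)) (s≤s (∣⇒≤ c∣y′))))))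

  Coprime⇒coprimeᵇ : ∀ {x d} → Coprime x (suc d) → coprimeᵇ x (suc d) ≡ true
  Coprime⇒coprimeᵇ {x} {d} cop = all<-intro {suc (suc d)} λ r _ → not-intro (no-common-divisor r)
    where
    no-common-divisor : ∀ r → ((2 ≤ᵇ r) ∧ (dividesᵇ r x ∧ dividesᵇ r (suc d))) ≡ false
    no-common-divisor r with false-or-true ((2 ≤ᵇ r) ∧ (dividesᵇ r x ∧ dividesᵇ r (suc d)))
    ... | inj₁ e = e
    ... | inj₂ e = ⊥-elim (<⇒≱ (≤ᵇ⇒≤′ (∧-elimˡ e)) (≤-reflexive (cop
            (dividesᵇ⇒∣ (∧-elimˡ {dividesᵇ r x} (∧-elimʳ {2 ≤ᵇ r} e)) ,
             dividesᵇ⇒∣ (∧-elimʳ {dividesᵇ r x} (∧-elimʳ {2 ≤ᵇ r} e))))))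

  primeᵇ : ℕ → Bool
  primeᵇ r = (2 ≤ᵇ r) ∧ all< r (λ q → not ((2 ≤ᵇ q) ∧ dividesᵇ q r))

  primeᵇ⇒Prime : ∀ {r} → primeᵇ r ≡ true → Prime r
  primeᵇ⇒Prime {r} e = prime {{n>1⇒nonTrivial (≤ᵇ⇒≤′ (∧-elimˡ e))}} not-composite
    where
    not-composite : ¬ Composite r
    not-composite (hasNonTrivialDivisor {d} d<r d∣r) = true≢false (trans
      (sym (∧-intro (≤⇒≤ᵇ′ (nonTrivial⇒n>1 d)) (∣⇒dividesᵇ d∣r)))
      (not-elim (all<-elim {r} (∧-elimʳ {2 ≤ᵇ r} e) d d<r)))

  Prime⇒primeᵇ : ∀ {r} → Prime r → primeᵇ r ≡ true
  Prime⇒primeᵇ {r} pr@(prime not-composite) =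
    ∧-intro (≤⇒≤ᵇ′ (nonTrivial⇒n>1 r {{prime⇒nonTrivial pr}})) (all<-intro {r} λ q q<r → not-intro (not-factor q q<r))
    where
    not-factor : ∀ q → q < r → ((2 ≤ᵇ q) ∧ dividesᵇ q r) ≡ false
    not-factor q q<r with false-or-true ((2 ≤ᵇ q) ∧ dividesᵇ q r)
    ... | inj₁ e = e
    ... | inj₂ e = ⊥-elim (not-composite (hasNonTrivialDivisor {divisor = q} {{n>1⇒nonTrivial (≤ᵇ⇒≤′ (∧-elimˡ e))}}
                             q<r (dividesᵇ⇒∣ (∧-elimʳ {2 ≤ᵇ q} e))))

  module ArithmeticExpressions (S : Signature) where
    open Syntax S

    dividesE : BExp 2
    dividesE = anyB (add (lit 1) v₁) (eqB (mul v₀ v₁) v₂)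

    coprimeE : BExp 2
    coprimeE = allB (add (lit 1) v₁)
      (notB (andB (leB (lit 2) v₀) (andB (letB (v₀ ∷ v₁ ∷ []) dividesE) (letB (v₀ ∷ v₂ ∷ []) dividesE))))

    primeE : BExp 1
    primeE = andB (leB (lit 2) v₀) (allB v₀ (notB (andB (leB (lit 2) v₀) (letB (v₀ ∷ v₁ ∷ []) dividesE))))

open ArithmeticDecisions

module PrimeIndexing {p : ℕ → ℕ} (listing : PrimeListing p) where
  open PrimeListing listing

  -- Non-primes get index 0, so that the index function is total and computable by μ-search.
  isIndexOf : ℕ → ℕ → Bool
  isIndexOf r i = not (primeᵇ r) ∨ (p i ≡ᵇ r)

  private
    some-index : ∀ r → Σ ℕ λ i → isIndexOf r i ≡ true
    some-index r with primeᵇ r in e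
    ... | false = 0 , refl
    ... | true = proj₁ (surj r (primeᵇ⇒Prime e)) , ≡⇒≡ᵇ′ (proj₂ (surj r (primeᵇ⇒Prime e)))

  primeIndex-least : ∀ r → Σ ℕ (Least (isIndexOf r))
  primeIndex-least r = least (isIndexOf r) (proj₁ (some-index r)) (proj₂ (some-index r))

  primeIndex : ℕ → ℕ
  primeIndex r = proj₁ (primeIndex-least r)

  primeIndex-correct : ∀ r → Prime r → p (primeIndex r) ≡ r
  primeIndex-correct r r-prime = ≡ᵇ⇒≡′ (subst (λ b → not b ∨ (p (primeIndex r) ≡ᵇ r) ≡ true) (Prime⇒primeᵇ r-prime)
                                                (proj₁ (proj₂ (primeIndex-least r))))

  primeIndex-p : ∀ i → primeIndex (p i) ≡ i
  primeIndex-p i = inj _ _ (primeIndex-correct (p i) (all-prime i))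

module RationalCodes where

  -- A rational with numerator ±n and denominator d + 1 is coded by the triple (sign, |numerator| − sign, d).
  encodeℚ : ℚ → ℕ
  encodeℚ (mkℚ (+ n) d _) = triple 0 n d
  encodeℚ (mkℚ -[1+ n ] d _) = triple 1 n d

  fromParts : ℕ → ℕ → ℕ → ℚ
  fromParts zero n d with coprime? n (suc d)
  ... | yes c = mkℚ (+ n) d c
  ... | no _ = 0ℚ
  fromParts (suc _) n d with coprime? (suc n) (suc d)
  ... | yes c = mkℚ -[1+ n ] d c
  ... | no _ = 0ℚ

  decodeℚ : ℕ → ℚ
  decodeℚ = uncurry₃ fromParts

  private
    fromParts-pos : ∀ n d (c : Coprime n (suc d)) → fromParts 0 n d ≡ mkℚ (+ n) d c
    fromParts-pos n d c with coprime? n (suc d)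
    ... | yes _ = refl
    ... | no ¬c = ⊥-elim (¬c c)

    fromParts-neg : ∀ s n d (c : Coprime (suc n) (suc d)) → fromParts (suc s) n d ≡ mkℚ -[1+ n ] d c
    fromParts-neg s n d c with coprime? (suc n) (suc d)
    ... | yes _ = refl
    ... | no ¬c = ⊥-elim (¬c c)

  decodeℚ-encodeℚ : ∀ q → decodeℚ (encodeℚ q) ≡ q
  decodeℚ-encodeℚ (mkℚ (+ n) d c) =
    trans (uncurry₃-triple fromParts 0 n d) (fromParts-pos n d (recompute (coprime? n (suc d)) c))
  decodeℚ-encodeℚ (mkℚ -[1+ n ] d c) =
    trans (uncurry₃-triple fromParts 1 n d) (fromParts-neg 0 n d (recompute (coprime? (suc n) (suc d)) c))

  encodeVec : ∀ {k} → Vec ℚ k → ℕ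
  encodeVec [] = 0
  encodeVec (q ∷ v) = pair (encodeℚ q) (encodeVec v)

  decodeVec : ∀ k → ℕ → Vec ℚ k
  decodeVec zero n = []
  decodeVec (suc k) n = decodeℚ (unpair₁ n) ∷ decodeVec k (unpair₂ n)

  decodeVec-encodeVec : ∀ {k} (v : Vec ℚ k) → decodeVec k (encodeVec v) ≡ v
  decodeVec-encodeVec [] = refl
  decodeVec-encodeVec {suc k} (q ∷ v) =
    cong₂ _∷_ (trans (cong decodeℚ (unpair₁-pair (encodeℚ q) (encodeVec v))) (decodeℚ-encodeℚ q))
              (trans (cong (decodeVec k) (unpair₂-pair (encodeℚ q) (encodeVec v))) (decodeVec-encodeVec v))

open RationalCodes

module ValidCodes {p : ℕ → ℕ} (listing : PrimeListing p) where
  open PrimeListing listing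
  open PrimeIndexing listing

  Primes : (ℕ → Bool) → ℕ → Set
  Primes X r = Σ ℕ λ i → X i ≡ true × p i ≡ r

  primeFactorsInᵇ : (ℕ → Bool) → ℕ → Bool
  primeFactorsInᵇ X D = all< (suc D) (λ r → not (primeᵇ r ∧ dividesᵇ r D) ∨ X (primeIndex r))

  validPartsᵇ : (ℕ → Bool) → ℕ → ℕ → ℕ → Bool
  validPartsᵇ X s n d = (s ≤ᵇ 1) ∧ (coprimeᵇ (s + n) (suc d) ∧ primeFactorsInᵇ X (suc d))

  validℚᵇ : (ℕ → Bool) → ℕ → Bool
  validℚᵇ X = uncurry₃ (validPartsᵇ X)

  validVecᵇ : (ℕ → Bool) → ℕ → ℕ → Bool
  validVecᵇ X zero n = n ≡ᵇ 0
  validVecᵇ X (suc k) n = validℚᵇ X (unpair₁ n) ∧ validVecᵇ X k (unpair₂ n)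

  primeFactorsInᵇ-sound : ∀ {X d} → primeFactorsInᵇ X (suc d) ≡ true → ∀ r → Prime r → r ∣ suc d → Primes X r
  primeFactorsInᵇ-sound {X} {d} e r r-prime r∣
    with ∨-elim {not (primeᵇ r ∧ dividesᵇ r (suc d))} (all<-elim {suc (suc d)} e r (s≤s (∣⇒≤ r∣)))
  ... | inj₁ e′ = ⊥-elim (true≢false (trans (sym (∧-intro (Prime⇒primeᵇ r-prime) (∣⇒dividesᵇ r∣))) (not-elim e′)))
  ... | inj₂ e′ = primeIndex r , e′ , primeIndex-correct r r-prime

  primeFactorsInᵇ-complete : ∀ {X d} → (∀ r → Prime r → r ∣ suc d → Primes X r) → primeFactorsInᵇ X (suc d) ≡ true
  primeFactorsInᵇ-complete {X} {d} h = all<-intro {suc (suc d)} λ r _ → factor-in-X r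
    where
    factor-in-X : ∀ r → (not (primeᵇ r ∧ dividesᵇ r (suc d)) ∨ X (primeIndex r)) ≡ true
    factor-in-X r with false-or-true (primeᵇ r ∧ dividesᵇ r (suc d))
    ... | inj₁ e = ∨-introˡ (not-intro e)
    ... | inj₂ e with h r (primeᵇ⇒Prime (∧-elimˡ e)) (dividesᵇ⇒∣ (∧-elimʳ {primeᵇ r} e))
    ...   | i , Xi , pi≡r = ∨-introʳ {not (primeᵇ r ∧ dividesᵇ r (suc d))}
             (subst (λ r → X (primeIndex r) ≡ true) pi≡r (subst (λ j → X j ≡ true) (sym (primeIndex-p i)) Xi))

  validℚᵇ-encodeℚ : ∀ {X} q → InO (Primes X) q → validℚᵇ X (encodeℚ q) ≡ true
  validℚᵇ-encodeℚ {X} (mkℚ (+ n) d c) h = trans (uncurry₃-triple (validPartsᵇ X) 0 n d)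
    (∧-intro refl (∧-intro (Coprime⇒coprimeᵇ (recompute (coprime? n (suc d)) c)) (primeFactorsInᵇ-complete h)))
  validℚᵇ-encodeℚ {X} (mkℚ -[1+ n ] d c) h = trans (uncurry₃-triple (validPartsᵇ X) 1 n d)
    (∧-intro refl (∧-intro (Coprime⇒coprimeᵇ (recompute (coprime? (suc n) (suc d)) c)) (primeFactorsInᵇ-complete h)))

  validℚᵇ-decodeℚ : ∀ {X} a → validℚᵇ X a ≡ true → encodeℚ (decodeℚ a) ≡ a × InO (Primes X) (decodeℚ a)
  validℚᵇ-decodeℚ {X} a = subst P (triple-unpair a) (on-triple (unpair₁ a) (unpair₁ (unpair₂ a)) (unpair₂ (unpair₂ a)))
    where
    P : ℕ → Set
    P a = validℚᵇ X a ≡ true → encodeℚ (decodeℚ a) ≡ a × InO (Primes X) (decodeℚ a)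
    on-parts : ∀ s n d → validPartsᵇ X s n d ≡ true →
               encodeℚ (fromParts s n d) ≡ triple s n d × InO (Primes X) (fromParts s n d)
    on-parts zero n d e with coprime? n (suc d)
    ... | yes _ = refl , primeFactorsInᵇ-sound (∧-elimʳ {coprimeᵇ n (suc d)} (∧-elimʳ {0 ≤ᵇ 1} e))
    ... | no ¬c = ⊥-elim (¬c (coprimeᵇ⇒Coprime (∧-elimˡ (∧-elimʳ {0 ≤ᵇ 1} e))))
    on-parts (suc zero) n d e with coprime? (suc n) (suc d)
    ... | yes _ = refl , primeFactorsInᵇ-sound (∧-elimʳ {coprimeᵇ (suc n) (suc d)} (∧-elimʳ {1 ≤ᵇ 1} e))
    ... | no ¬c = ⊥-elim (¬c (coprimeᵇ⇒Coprime (∧-elimˡ (∧-elimʳ {1 ≤ᵇ 1} e))))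
    on-triple : ∀ s n d → P (triple s n d)
    on-triple s n d e rewrite uncurry₃-triple fromParts s n d = on-parts s n d (trans (sym (uncurry₃-triple (validPartsᵇ X) s n d)) e)

  validVecᵇ-encodeVec : ∀ {X k} (v : Vec ℚ k) → OVec (Primes X) v → validVecᵇ X k (encodeVec v) ≡ true
  validVecᵇ-encodeVec [] [] = refl
  validVecᵇ-encodeVec {X} {suc k} (q ∷ v) (h ∷ hs) =
    ∧-intro (trans (cong (validℚᵇ X) (unpair₁-pair (encodeℚ q) (encodeVec v))) (validℚᵇ-encodeℚ q h))
            (trans (cong (validVecᵇ X k) (unpair₂-pair (encodeℚ q) (encodeVec v))) (validVecᵇ-encodeVec v hs))

  validVecᵇ-decodeVec : ∀ {X} k n → validVecᵇ X k n ≡ true → encodeVec (decodeVec k n) ≡ n × OVec (Primes X) (decodeVec k n)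
  validVecᵇ-decodeVec zero n e = sym (≡ᵇ⇒≡′ e) , []
  validVecᵇ-decodeVec {X} (suc k) n e
    with validℚᵇ-decodeℚ {X} (unpair₁ n) (∧-elimˡ e)
       | validVecᵇ-decodeVec {X} k (unpair₂ n) (∧-elimʳ {validℚᵇ X (unpair₁ n)} e)
  ... | e₁ , h₁ | e₂ , h₂ = trans (cong₂ pair e₁ e₂) (pair-unpair n) , (h₁ ∷ h₂)

module RationalArithmetic where

  CrossSum : ℚ → ℚ → ℚ → Set
  CrossSum x y z = ↥ z ℤ.* (↧ x ℤ.* ↧ y) ≡ (↥ x ℤ.* ↧ y ℤ.+ ↥ y ℤ.* ↧ x) ℤ.* ↧ z

  private
    toℚᵘ-+ : ∀ x y →
      toℚᵘ x ℚᵘ.+ toℚᵘ y ℚᵘ.≃ ℚᵘ.mkℚᵘ (↥ x ℤ.* ↧ y ℤ.+ ↥ y ℤ.* ↧ x) (pred (↧ₙ x * ↧ₙ y))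
    toℚᵘ-+ (mkℚ _ _ _) (mkℚ _ _ _) = ℚᵘ.≃-refl

  +≡⇒CrossSum : ∀ x y z → x ℚ.+ y ≡ z → CrossSum x y z
  +≡⇒CrossSum x@(mkℚ _ dx _) y@(mkℚ _ dy _) z@(mkℚ _ _ _) e
    with ℚᵘ.≃-trans (ℚᵘ.≃-reflexive (cong toℚᵘ (sym e))) (ℚᵘ.≃-trans (ℚ.toℚᵘ-homo-+ x y) (toℚᵘ-+ x y))
  ... | ℚᵘ.*≡* eq = trans (cong (↥ z ℤ.*_) (sym (ℤ.pos-* (suc dx) (suc dy)))) eq

  CrossSum⇒+≡ : ∀ x y z → CrossSum x y z → x ℚ.+ y ≡ z
  CrossSum⇒+≡ x@(mkℚ _ dx _) y@(mkℚ _ dy _) z@(mkℚ _ _ _) eq =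
    ℚ.toℚᵘ-injective (ℚᵘ.≃-trans (ℚ.toℚᵘ-homo-+ x y) (ℚᵘ.≃-trans (toℚᵘ-+ x y)
      (ℚᵘ.≃-sym (ℚᵘ.*≡* (trans (cong (↥ z ℤ.*_) (ℤ.pos-* (suc dx) (suc dy))) eq)))))

  ↧ₙ-+-∣ : ∀ x y → ↧ₙ (x ℚ.+ y) ∣ ↧ₙ x * ↧ₙ y
  ↧ₙ-+-∣ x@(mkℚ _ _ _) y@(mkℚ _ _ _) = divides g (trans (ℤ.+-injective (sym e)) (*-comm (↧ₙ (x ℚ.+ y)) g))
    where
    i = ↥ x ℤ.* ↧ y ℤ.+ ↥ y ℤ.* ↧ x
    n = ↧ₙ x * ↧ₙ y
    g = gcd ℤ.∣ i ∣ n
    e : + (↧ₙ (x ℚ.+ y) * g) ≡ + n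
    e = trans (ℤ.pos-* (↧ₙ (x ℚ.+ y)) g) (ℚ.↧-/ i n)

  ↧ₙ-neg : ∀ q → ↧ₙ (ℚ.- q) ≡ ↧ₙ q
  ↧ₙ-neg (mkℚ (+ zero) _ _) = refl
  ↧ₙ-neg (mkℚ ℤ.+[1+ _ ] _ _) = refl
  ↧ₙ-neg (mkℚ -[1+ _ ] _ _) = refl

  times : ℕ → ℚ → ℚ
  times zero q = 0ℚ
  times (suc m) q = q ℚ.+ times m q

  private
    toℚᵘ-times : ∀ m q → toℚᵘ (times m q) ℚᵘ.≃ ℚᵘ.mkℚᵘ (+ m ℤ.* ↥ q) (ℚ.denominator-1 q)
    toℚᵘ-times zero (mkℚ n d _) = ℚᵘ.*≡* (trans (ℤ.*-zeroˡ (+ suc d)) (sym (cong (ℤ._* + 1) (ℤ.*-zeroˡ n))))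
    toℚᵘ-times (suc m) q@(mkℚ n d _) = ℚᵘ.≃-trans (ℚ.toℚᵘ-homo-+ q (times m q))
      (ℚᵘ.≃-trans (ℚᵘ.+-congʳ (toℚᵘ q) (toℚᵘ-times m q)) (ℚᵘ.*≡* eq))
      where
      D = + suc d
      ring-identity : ∀ n D M → (n ℤ.* D ℤ.+ (M ℤ.* n) ℤ.* D) ℤ.* D ≡ ((+ 1 ℤ.+ M) ℤ.* n) ℤ.* (D ℤ.* D)
      ring-identity = solve-∀
      eq : (n ℤ.* D ℤ.+ (+ m ℤ.* n) ℤ.* D) ℤ.* D ≡ (+ suc m ℤ.* n) ℤ.* (D ℤ.* D)
      eq = trans (ring-identity n D (+ m)) (cong (λ t → (t ℤ.* n) ℤ.* (D ℤ.* D)) (sym (ℤ.pos-+ 1 m)))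

  times≡1⇒↧ₙ≡ : ∀ m q → times m q ≡ 1ℚ → ↧ₙ q ≡ m * ℤ.∣ ↥ q ∣
  times≡1⇒↧ₙ≡ m q@(mkℚ n d _) e
    with ℚᵘ.≃-trans (ℚᵘ.≃-sym (toℚᵘ-times m q)) (ℚᵘ.≃-reflexive (cong toℚᵘ e))
  ... | ℚᵘ.*≡* eq = trans (cong ℤ.∣_∣ d≡) (ℤ.abs-* (+ m) n)
    where
    d≡ : + suc d ≡ + m ℤ.* n
    d≡ = sym (trans (sym (ℤ.*-identityʳ (+ m ℤ.* n))) (trans eq (ℤ.*-identityˡ (+ suc d))))

  -- Junk value 1/0 = 0.
  1/ℕ : ℕ → ℚ
  1/ℕ zero = 0ℚ
  1/ℕ (suc m) = mkℚ (+ 1) m (Coprimality.1-coprimeTo (suc m))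

  times-1/ℕ : ∀ n → n ≢ 0 → times n (1/ℕ n) ≡ 1ℚ
  times-1/ℕ zero n≢0 = ⊥-elim (n≢0 refl)
  times-1/ℕ (suc m) _ = ℚ.toℚᵘ-injective (ℚᵘ.≃-trans (toℚᵘ-times (suc m) (1/ℕ (suc m)))
    (ℚᵘ.*≡* (trans (ℤ.*-identityʳ (+ suc m ℤ.* + 1)) (trans (ℤ.*-identityʳ (+ suc m)) (sym (ℤ.*-identityˡ (+ suc m)))))))

  fromℤ : ℤ → ℚ
  fromℤ z = mkℚ z 0 (Coprimality.sym (Coprimality.1-coprimeTo ℤ.∣ z ∣))

  fromℤ-+ : ∀ a b → fromℤ a ℚ.+ fromℤ b ≡ fromℤ (a ℤ.+ b)
  fromℤ-+ a b = CrossSum⇒+≡ (fromℤ a) (fromℤ b) (fromℤ (a ℤ.+ b)) (ring-identity a b)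
    where
    ring-identity : ∀ a b → (a ℤ.+ b) ℤ.* (+ 1 ℤ.* + 1) ≡ (a ℤ.* + 1 ℤ.+ b ℤ.* + 1) ℤ.* + 1
    ring-identity = solve-∀

  fromℤ-↥ : ∀ q → ↧ₙ q ≡ 1 → q ≡ fromℤ (↥ q)
  fromℤ-↥ (mkℚ n zero c) e = refl

open RationalArithmetic

-- Deciding x + y ≡ z on codes by cross-multiplication; the numerator of a code is split into a
-- positive and a negative part so that the test is an equation between natural numbers.
module SumCheck where

  numerator⁺ numerator⁻ denominator : ℕ → ℕ
  numerator⁺ = uncurry₃ λ s n d → (1 ∸ s) * n
  numerator⁻ = uncurry₃ λ s n d → s * (s + n)
  denominator = uncurry₃ λ s n d → 1 + d

  crossLeft crossRight : ℕ → ℕ → ℕ → ℕ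
  crossLeft a b c = numerator⁺ c * (denominator a * denominator b) + numerator⁻ a * (denominator b * denominator c)
                    + numerator⁻ b * (denominator a * denominator c)
  crossRight a b c = numerator⁻ c * (denominator a * denominator b) + numerator⁺ a * (denominator b * denominator c)
                     + numerator⁺ b * (denominator a * denominator c)

  sumCheckᵇ : ℕ → ℕ → ℕ → Bool
  sumCheckᵇ a b c = crossLeft a b c ≡ᵇ crossRight a b c

  private
    ↥-encodeℚ : ∀ q → ↥ q ≡ + numerator⁺ (encodeℚ q) ℤ.- + numerator⁻ (encodeℚ q)
    ↥-encodeℚ (mkℚ (+ n) d _)
      rewrite uncurry₃-triple (λ s n d → (1 ∸ s) * n) 0 n d | uncurry₃-triple (λ s n d → s * (s + n)) 0 n d =
      trans (cong +_ (sym (+-identityʳ n))) (sym (ℤ.+-identityʳ (+ (n + 0))))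
    ↥-encodeℚ (mkℚ -[1+ n ] d _)
      rewrite uncurry₃-triple (λ s n d → (1 ∸ s) * n) 1 n d | uncurry₃-triple (λ s n d → s * (s + n)) 1 n d =
      cong (λ t → ℤ.- (+ t)) (sym (+-identityʳ (suc n)))

    ↧-encodeℚ : ∀ q → ↧ q ≡ + denominator (encodeℚ q)
    ↧-encodeℚ (mkℚ (+ n) d _) rewrite uncurry₃-triple (λ s n d → 1 + d) 0 n d = refl
    ↧-encodeℚ (mkℚ -[1+ n ] d _) rewrite uncurry₃-triple (λ s n d → 1 + d) 1 n d = refl

    +-sum-of-products : ∀ a b c d e f g h i →
      + (a * (b * c) + d * (e * f) + g * (h * i))
      ≡ + a ℤ.* (+ b ℤ.* + c) ℤ.+ + d ℤ.* (+ e ℤ.* + f) ℤ.+ + g ℤ.* (+ h ℤ.* + i)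
    +-sum-of-products a b c d e f g h i = trans (ℤ.pos-+ (a * (b * c) + d * (e * f)) (g * (h * i)))
      (cong₂ ℤ._+_ (trans (ℤ.pos-+ (a * (b * c)) (d * (e * f))) (cong₂ ℤ._+_ (+-product a b c) (+-product d e f)))
                   (+-product g h i))
      where
      +-product : ∀ a b c → + (a * (b * c)) ≡ + a ℤ.* (+ b ℤ.* + c)
      +-product a b c = trans (ℤ.pos-* a (b * c)) (cong (+ a ℤ.*_) (ℤ.pos-* b c))

    ring-identity : ∀ px qx py qy pz qz dx dy dz →
      (pz ℤ.- qz) ℤ.* (dx ℤ.* dy) ℤ.- ((px ℤ.- qx) ℤ.* dy ℤ.+ (py ℤ.- qy) ℤ.* dx) ℤ.* dz
      ≡ (pz ℤ.* (dx ℤ.* dy) ℤ.+ qx ℤ.* (dy ℤ.* dz) ℤ.+ qy ℤ.* (dx ℤ.* dz))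
        ℤ.- (qz ℤ.* (dx ℤ.* dy) ℤ.+ px ℤ.* (dy ℤ.* dz) ℤ.+ py ℤ.* (dx ℤ.* dz))
    ring-identity = solve-∀

    crossDifference-in-parts : ∀ {Zx Zy Zz Dx Dy Dz} px qx py qy pz qz dx dy dz →
      Zx ≡ + px ℤ.- + qx → Zy ≡ + py ℤ.- + qy → Zz ≡ + pz ℤ.- + qz → Dx ≡ + dx → Dy ≡ + dy → Dz ≡ + dz →
      Zz ℤ.* (Dx ℤ.* Dy) ℤ.- (Zx ℤ.* Dy ℤ.+ Zy ℤ.* Dx) ℤ.* Dz
      ≡ + (pz * (dx * dy) + qx * (dy * dz) + qy * (dx * dz)) ℤ.- + (qz * (dx * dy) + px * (dy * dz) + py * (dx * dz))
    crossDifference-in-parts px qx py qy pz qz dx dy dz refl refl refl refl refl refl =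
      trans (ring-identity (+ px) (+ qx) (+ py) (+ qy) (+ pz) (+ qz) (+ dx) (+ dy) (+ dz))
            (sym (cong₂ ℤ._-_ (+-sum-of-products pz dx dy qx dy dz qy dx dz) (+-sum-of-products qz dx dy px dy dz py dx dz)))

    crossDifference : ∀ x y z → let a = encodeℚ x ; b = encodeℚ y ; c = encodeℚ z in
      ↥ z ℤ.* (↧ x ℤ.* ↧ y) ℤ.- (↥ x ℤ.* ↧ y ℤ.+ ↥ y ℤ.* ↧ x) ℤ.* ↧ z
      ≡ + crossLeft a b c ℤ.- + crossRight a b c
    crossDifference x y z = crossDifference-in-parts
      (numerator⁺ a) (numerator⁻ a) (numerator⁺ b) (numerator⁻ b) (numerator⁺ c) (numerator⁻ c)
      (denominator a) (denominator b) (denominator c)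
      (↥-encodeℚ x) (↥-encodeℚ y) (↥-encodeℚ z) (↧-encodeℚ x) (↧-encodeℚ y) (↧-encodeℚ z)
      where a = encodeℚ x ; b = encodeℚ y ; c = encodeℚ z

  sumCheckᵇ-sound : ∀ x y z → sumCheckᵇ (encodeℚ x) (encodeℚ y) (encodeℚ z) ≡ true → x ℚ.+ y ≡ z
  sumCheckᵇ-sound x y z e = CrossSum⇒+≡ x y z (ℤ.i-j≡0⇒i≡j _ _
    (trans (crossDifference x y z) (ℤ.i≡j⇒i-j≡0 (cong +_ (≡ᵇ⇒≡′ {crossLeft a b c} {crossRight a b c} e)))))
    where a = encodeℚ x ; b = encodeℚ y ; c = encodeℚ z

  sumCheckᵇ-complete : ∀ x y z → x ℚ.+ y ≡ z → sumCheckᵇ (encodeℚ x) (encodeℚ y) (encodeℚ z) ≡ true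
  sumCheckᵇ-complete x y z e = ≡⇒≡ᵇ′ {crossLeft a b c} {crossRight a b c}
    (ℤ.+-injective (ℤ.i-j≡0⇒i≡j (+ crossLeft a b c) (+ crossRight a b c)
    (trans (sym (crossDifference x y z)) (ℤ.i≡j⇒i-j≡0 (+≡⇒CrossSum x y z e)))))
    where a = encodeℚ x ; b = encodeℚ y ; c = encodeℚ z

  vecSumCheckᵇ : ℕ → ℕ → ℕ → ℕ → Bool
  vecSumCheckᵇ zero a b c = true
  vecSumCheckᵇ (suc k) a b c =
    sumCheckᵇ (unpair₁ a) (unpair₁ b) (unpair₁ c) ∧ vecSumCheckᵇ k (unpair₂ a) (unpair₂ b) (unpair₂ c)

open SumCheck

module ValidSums {p : ℕ → ℕ} (listing : PrimeListing p) where
  open ValidCodes listing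

  private
    sumCheckᵇ-encoded : ∀ x y z {a b c} → encodeℚ x ≡ a → encodeℚ y ≡ b → encodeℚ z ≡ c →
      (sumCheckᵇ a b c ≡ true → x ℚ.+ y ≡ z) × (x ℚ.+ y ≡ z → sumCheckᵇ a b c ≡ true)
    sumCheckᵇ-encoded x y z refl refl refl = sumCheckᵇ-sound x y z , sumCheckᵇ-complete x y z

  vecSumCheckᵇ-valid : ∀ {X} k a b c → validVecᵇ X k a ≡ true → validVecᵇ X k b ≡ true → validVecᵇ X k c ≡ true →
    (vecSumCheckᵇ k a b c ≡ true → decodeVec k a +v decodeVec k b ≡ decodeVec k c) ×
    (decodeVec k a +v decodeVec k b ≡ decodeVec k c → vecSumCheckᵇ k a b c ≡ true)
  vecSumCheckᵇ-valid zero a b c ha hb hc = (λ _ → refl) , (λ _ → refl)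
  vecSumCheckᵇ-valid {X} (suc k) a b c ha hb hc =
    (λ e → cong₂ _∷_ (proj₁ heads (∧-elimˡ e))
                     (proj₁ tails (∧-elimʳ {sumCheckᵇ (unpair₁ a) (unpair₁ b) (unpair₁ c)} e))) ,
    (λ e → ∧-intro (proj₂ heads (proj₁ (∷-injective e))) (proj₂ tails (proj₂ (∷-injective e))))
    where
    code-of-head : ∀ n → validVecᵇ X (suc k) n ≡ true → encodeℚ (decodeℚ (unpair₁ n)) ≡ unpair₁ n
    code-of-head n hn = proj₁ (validℚᵇ-decodeℚ {X} (unpair₁ n) (∧-elimˡ hn))
    tail-valid : ∀ n → validVecᵇ X (suc k) n ≡ true → validVecᵇ X k (unpair₂ n) ≡ true
    tail-valid n hn = ∧-elimʳ {validℚᵇ X (unpair₁ n)} hn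
    heads = sumCheckᵇ-encoded (decodeℚ (unpair₁ a)) (decodeℚ (unpair₁ b)) (decodeℚ (unpair₁ c))
              (code-of-head a ha) (code-of-head b hb) (code-of-head c hc)
    tails = vecSumCheckᵇ-valid k (unpair₂ a) (unpair₂ b) (unpair₂ c) (tail-valid a ha) (tail-valid b hb) (tail-valid c hc)

module RationalSubgroups where

  open import Data.Nat.Primality.Factorisation using (factorise)
  open import Data.Nat.ListAction using (product)
  open import Data.List using ([]; _∷_)
  import Data.List.Relation.Unary.All as List

  prime≢1 : ∀ {r} → Prime r → r ≢ 1
  prime≢1 r-prime refl = nonTrivial⇒≢1 {1} {{prime⇒nonTrivial r-prime}} refl

  InO-mono : ∀ {V W : ℕ → Set} → (∀ r → V r → W r) → ∀ {q} → InO V q → InO W q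
  InO-mono V⊆W h r r-prime r∣ = V⊆W r (h r r-prime r∣)

  ↧ₙ≡1⇒InO : ∀ V q → ↧ₙ q ≡ 1 → InO V q
  ↧ₙ≡1⇒InO V q e r r-prime r∣ = ⊥-elim (prime≢1 r-prime (∣1⇒≡1 (subst (r ∣_) e r∣)))

  InO-0 : ∀ V → InO V 0ℚ
  InO-0 V = ↧ₙ≡1⇒InO V 0ℚ refl

  InO-+ : ∀ V x y → InO V x → InO V y → InO V (x ℚ.+ y)
  InO-+ V x y hx hy r r-prime r∣ with euclidsLemma (↧ₙ x) (↧ₙ y) r-prime (∣-trans r∣ (↧ₙ-+-∣ x y))
  ... | inj₁ r∣x = hx r r-prime r∣x
  ... | inj₂ r∣y = hy r r-prime r∣y

  InO-neg : ∀ V x → InO V x → InO V (ℚ.- x)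
  InO-neg V x h r r-prime r∣ = h r r-prime (subst (r ∣_) (↧ₙ-neg x) r∣)

  private
    no-prime-factor⇒≡1 : ∀ n → .{{_ : NonZero n}} → (∀ r → Prime r → r ∣ n → ⊥) → n ≡ 1
    no-prime-factor⇒≡1 n h with factorise n
    ... | record { factors = [] ; isFactorisation = e } = e
    ... | record { factors = f ∷ fs ; isFactorisation = e ; factorsPrime = f-prime List.∷ _ } =
          ⊥-elim (h f f-prime (subst (f ∣_) (sym e) (m∣m*n (product fs))))

  InO-∅⇒↧ₙ≡1 : ∀ {V} → (∀ r → ¬ V r) → ∀ q → InO V q → ↧ₙ q ≡ 1
  InO-∅⇒↧ₙ≡1 V-empty (mkℚ _ d _) h = no-prime-factor⇒≡1 (suc d) (λ r r-prime r∣ → V-empty r (h r r-prime r∣))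

  OVec-0 : ∀ V k → OVec V (0v {k})
  OVec-0 V zero = []
  OVec-0 V (suc k) = InO-0 V ∷ OVec-0 V k

  OVec-+ : ∀ V {k} (u w : Vec ℚ k) → OVec V u → OVec V w → OVec V (u +v w)
  OVec-+ V [] [] [] [] = []
  OVec-+ V (x ∷ u) (y ∷ w) (hx ∷ hu) (hy ∷ hw) = InO-+ V x y hx hy ∷ OVec-+ V u w hu hw

  OVec-neg : ∀ V {k} (u : Vec ℚ k) → OVec V u → OVec V (-v u)
  OVec-neg V [] [] = []
  OVec-neg V (x ∷ u) (h ∷ hs) = InO-neg V x h ∷ OVec-neg V u hs

  +v-identityˡ : ∀ {k} (w : Vec ℚ k) → 0v +v w ≡ w
  +v-identityˡ [] = refl
  +v-identityˡ (x ∷ w) = cong₂ _∷_ (ℚ.+-identityˡ x) (+v-identityˡ w)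

  timesVec : ∀ {k} → ℕ → Vec ℚ k → Vec ℚ k
  timesVec zero v = 0v
  timesVec (suc m) v = v +v timesVec m v

  timesVec-∷ : ∀ {k} m x (v : Vec ℚ k) → timesVec m (x ∷ v) ≡ times m x ∷ timesVec m v
  timesVec-∷ zero x v = refl
  timesVec-∷ (suc m) x v rewrite timesVec-∷ m x v = refl

  timesVec-0v : ∀ {k} m → timesVec m (0v {k}) ≡ 0v
  timesVec-0v zero = refl
  timesVec-0v (suc m) = trans (cong (0v +v_) (timesVec-0v m)) (+v-identityˡ 0v)

open RationalSubgroups

module StructureFacts where

  multiple : Str → ℕ → ℕ → ℕ
  multiple S zero a = zer S
  multiple S (suc m) a = plus S a (multiple S m a)

  record ClosedSubset (S : Str) : Set where
    field
      zer-∈ : zer S ∈D S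
      plus-∈ : ∀ a b → a ∈D S → b ∈D S → plus S a b ∈D S

  multiple-∈ : ∀ {S} → ClosedSubset S → ∀ m a → a ∈D S → multiple S m a ∈D S
  multiple-∈ closed zero a ha = ClosedSubset.zer-∈ closed
  multiple-∈ closed (suc m) a ha = ClosedSubset.plus-∈ closed a _ ha (multiple-∈ closed m a ha)

  Embedding-multiple : ∀ {S T σ} → Embedding S T σ → ClosedSubset S →
                       ∀ m a → a ∈D S → σ (multiple S m a) ≡ multiple T m (σ a)
  Embedding-multiple emb closed zero a ha = Embedding.emb-zer emb
  Embedding-multiple {S} {T} {σ} emb closed (suc m) a ha =
    trans (Embedding.emb-plus emb a (multiple S m a) ha (multiple-∈ closed m a ha))
          (cong (plus T (σ a)) (Embedding-multiple emb closed m a ha))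

  HomEmb⇒ClosedSubset : ∀ {k S} {ι : ℕ → Vec ℚ k} → HomEmb S ι → ClosedSubset S
  HomEmb⇒ClosedSubset h = record { zer-∈ = HomEmb.zer-dom h ; plus-∈ = HomEmb.plus-dom h }

  Iso⇒ClosedSubset : ∀ {S T τ} → Iso S T τ → ClosedSubset S → ClosedSubset T
  Iso⇒ClosedSubset {S} {T} {τ} iso closed = record { zer-∈ = subst (_∈D T) emb-zer (emb-dom _ zer-∈) ; plus-∈ = plus-∈′ }
    where
    open Iso iso
    open Embedding iso-emb
    open ClosedSubset closed
    plus-∈′ : ∀ a b → a ∈D T → b ∈D T → plus T a b ∈D T
    plus-∈′ a b ha hb with iso-surj a ha | iso-surj b hb
    ... | a′ , ha′ , refl | b′ , hb′ , refl =
      subst (_∈D T) (emb-plus a′ b′ ha′ hb′) (emb-dom _ (plus-∈ a′ b′ ha′ hb′))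

  ⊂⇒Embedding : ∀ {S T} → S ⊂ T → Embedding S T (λ x → x)
  ⊂⇒Embedding S⊂T = record
    { emb-dom = _⊂_.sub-dom S⊂T ; emb-inj = λ _ _ _ _ e → e ; emb-plus = _⊂_.sub-plus S⊂T ; emb-zer = _⊂_.sub-zer S⊂T }

  Embedding-restrict : ∀ {R S T σ} → R ⊂ S → Embedding S T σ → Embedding R T σ
  Embedding-restrict {σ = σ} R⊂S emb = record
    { emb-dom = λ a ha → emb-dom a (sub-dom a ha)
    ; emb-inj = λ a b ha hb → emb-inj a b (sub-dom a ha) (sub-dom b hb)
    ; emb-plus = λ a b ha hb → trans (cong σ (sub-plus a b ha hb)) (emb-plus a b (sub-dom a ha) (sub-dom b hb))
    ; emb-zer = trans (cong σ sub-zer) emb-zer }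
    where
    open _⊂_ R⊂S
    open Embedding emb

  module _ {S T : Str} {τ : ℕ → ℕ} (iso : Iso S T τ) where
    open Iso iso
    open Embedding iso-emb

    preimage : ∀ b → b ∈D T → ℕ
    preimage b hb = proj₁ (iso-surj b hb)

    preimage-∈ : ∀ b hb → preimage b hb ∈D S
    preimage-∈ b hb = proj₁ (proj₂ (iso-surj b hb))

    τ-preimage : ∀ b hb → τ (preimage b hb) ≡ b
    τ-preimage b hb = proj₂ (proj₂ (iso-surj b hb))

    preimage-unique : ∀ b (hb hb′ : b ∈D T) → preimage b hb ≡ preimage b hb′
    preimage-unique b hb hb′ =
      emb-inj _ _ (preimage-∈ b hb) (preimage-∈ b hb′) (trans (τ-preimage b hb) (sym (τ-preimage b hb′)))

    preimage-τ : ∀ a (ha : a ∈D S) (hτa : τ a ∈D T) → preimage (τ a) hτa ≡ a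
    preimage-τ a ha hτa = emb-inj _ a (preimage-∈ (τ a) hτa) ha (τ-preimage (τ a) hτa)

    private
      transportAlongOn : ∀ {k} → (ℕ → Vec ℚ k) → ∀ b x → dom T b ≡ x → Vec ℚ k
      transportAlongOn ι b true hb = ι (preimage b hb)
      transportAlongOn ι b false _ = 0v

    -- ι ∘ τ⁻¹, with a junk value outside the universe of T.
    transportAlong : ∀ {k} → (ℕ → Vec ℚ k) → ℕ → Vec ℚ k
    transportAlong ι b = transportAlongOn ι b (dom T b) refl

    transportAlong-∈ : ∀ {k} (ι : ℕ → Vec ℚ k) b (hb : b ∈D T) → transportAlong ι b ≡ ι (preimage b hb)
    transportAlong-∈ ι b hb = on-membership (dom T b) refl
      where
      on-membership : ∀ x (e : dom T b ≡ x) → transportAlongOn ι b x e ≡ ι (preimage b hb)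
      on-membership true e = cong ι (preimage-unique b e hb)
      on-membership false e = ⊥-elim (true≢false (trans (sym hb) e))

    transportAlong-τ : ∀ {k} (ι : ℕ → Vec ℚ k) a → a ∈D S → transportAlong ι (τ a) ≡ ι a
    transportAlong-τ ι a ha = trans (transportAlong-∈ ι (τ a) (emb-dom a ha)) (cong ι (preimage-τ a ha (emb-dom a ha)))

  InC-Iso : ∀ k {S T τ} → Iso S T τ → InC k S → InC k T
  InC-Iso k {S} {T} {τ} iso (ι , hom , neg) = ι′ , hom′ , neg′
    where
    open Iso iso
    open Embedding iso-emb
    open HomEmb hom
    ι′ = transportAlong iso ι
    pre = preimage iso
    pre-∈ = preimage-∈ iso
    ι′≡ = transportAlong-∈ iso ι

    plus-pre : ∀ a b ha hb → τ (plus S (pre a ha) (pre b hb)) ≡ plus T a b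
    plus-pre a b ha hb = trans (emb-plus _ _ (pre-∈ a ha) (pre-∈ b hb)) (cong₂ (plus T) (τ-preimage iso a ha) (τ-preimage iso b hb))

    hom′ : HomEmb T ι′
    hom′ = record
      { zer-dom = ClosedSubset.zer-∈ (Iso⇒ClosedSubset iso (HomEmb⇒ClosedSubset hom))
      ; plus-dom = ClosedSubset.plus-∈ (Iso⇒ClosedSubset iso (HomEmb⇒ClosedSubset hom))
      ; ι-inj = λ a b ha hb e → trans (sym (τ-preimage iso a ha)) (trans (cong τ (ι-inj _ _ (pre-∈ a ha) (pre-∈ b hb)
                   (trans (sym (ι′≡ a ha)) (trans e (ι′≡ b hb))))) (τ-preimage iso b hb))
      ; ι-plus = λ a b ha hb →
          trans (cong ι′ (sym (plus-pre a b ha hb)))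
            (trans (transportAlong-τ iso ι _ (plus-dom _ _ (pre-∈ a ha) (pre-∈ b hb)))
              (trans (ι-plus _ _ (pre-∈ a ha) (pre-∈ b hb)) (cong₂ _+v_ (sym (ι′≡ a ha)) (sym (ι′≡ b hb)))))
      ; ι-zer = trans (cong ι′ (sym emb-zer)) (trans (transportAlong-τ iso ι _ zer-dom) ι-zer) }

    neg′ : ∀ a → a ∈D T → Σ ℕ λ b → b ∈D T × ι′ b ≡ -v (ι′ a)
    neg′ a ha with neg (pre a ha) (pre-∈ a ha)
    ... | b , hb , e = τ b , emb-dom b hb , trans (transportAlong-τ iso ι b hb) (trans e (cong -v_ (sym (ι′≡ a ha))))

  Presents-⇔ : ∀ {k T} {ι : ℕ → Vec ℚ k} {P P′ : Vec ℚ k → Set} →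
               (∀ v → P v → P′ v) → (∀ v → P′ v → P v) → Presents T P ι → Presents T P′ ι
  Presents-⇔ P⇒P′ P′⇒P (hom , in-P , onto-P) = hom , (λ a ha → P⇒P′ _ (in-P a ha)) , (λ v hv → onto-P v (P′⇒P v hv))

open StructureFacts

-- 𝒪 X is (O_{ℚ,V_X})^k with elements coded by encodeVec, V_X being the primes indexed by X.
module CodedGroups {p : ℕ → ℕ} (listing : PrimeListing p) (k : ℕ) where
  open ValidCodes listing

  𝒪 : (ℕ → Bool) → Str
  𝒪 X = record { dom = validVecᵇ X k ; plus = λ a b → encodeVec (decodeVec k a +v decodeVec k b) ; zer = encodeVec (0v {k}) }

  ∈𝒪⇒OVec : ∀ X a → a ∈D 𝒪 X → OVec (Primes X) (decodeVec k a)
  ∈𝒪⇒OVec X a ha = proj₂ (validVecᵇ-decodeVec k a ha)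

  encodeVec-decodeVec : ∀ X a → a ∈D 𝒪 X → encodeVec (decodeVec k a) ≡ a
  encodeVec-decodeVec X a ha = proj₁ (validVecᵇ-decodeVec k a ha)

  OVec⇒∈𝒪 : ∀ X (v : Vec ℚ k) → OVec (Primes X) v → encodeVec v ∈D 𝒪 X
  OVec⇒∈𝒪 X v = validVecᵇ-encodeVec v

  𝒪-HomEmb : ∀ X → HomEmb (𝒪 X) (decodeVec k)
  𝒪-HomEmb X = record
    { zer-dom = OVec⇒∈𝒪 X 0v (OVec-0 (Primes X) k)
    ; plus-dom = λ a b ha hb → OVec⇒∈𝒪 X _ (OVec-+ (Primes X) _ _ (∈𝒪⇒OVec X a ha) (∈𝒪⇒OVec X b hb))
    ; ι-inj = λ a b ha hb e → trans (sym (encodeVec-decodeVec X a ha)) (trans (cong encodeVec e) (encodeVec-decodeVec X b hb))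
    ; ι-plus = λ a b _ _ → decodeVec-encodeVec (decodeVec k a +v decodeVec k b)
    ; ι-zer = decodeVec-encodeVec 0v }

  𝒪-Presents : ∀ X → Presents (𝒪 X) (OVec (Primes X)) (decodeVec k)
  𝒪-Presents X = 𝒪-HomEmb X , ∈𝒪⇒OVec X , λ v hv → encodeVec v , OVec⇒∈𝒪 X v hv , decodeVec-encodeVec v

  𝒪-InC : ∀ X → InC k (𝒪 X)
  𝒪-InC X = decodeVec k , 𝒪-HomEmb X , λ a ha →
    encodeVec (-v decodeVec k a) , OVec⇒∈𝒪 X _ (OVec-neg (Primes X) _ (∈𝒪⇒OVec X a ha)) ,
    decodeVec-encodeVec (-v decodeVec k a)

  𝒪-ClosedSubset : ∀ X → ClosedSubset (𝒪 X)
  𝒪-ClosedSubset X = HomEmb⇒ClosedSubset (𝒪-HomEmb X)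

  𝒪-mono : ∀ X Y → (∀ r → Primes X r → Primes Y r) → 𝒪 X ⊂ 𝒪 Y
  𝒪-mono X Y X⊆Y = record
    { sub-dom = λ a ha → subst (_∈D 𝒪 Y) (encodeVec-decodeVec X a ha)
                              (OVec⇒∈𝒪 Y _ (All.map (λ {q} → InO-mono X⊆Y {q}) (∈𝒪⇒OVec X a ha)))
    ; sub-plus = λ _ _ _ _ → refl
    ; sub-zer = refl }


  plus≡ᵇ≡vecSumCheckᵇ : ∀ X a b c → a ∈D 𝒪 X → b ∈D 𝒪 X → c ∈D 𝒪 X →
                        (plus (𝒪 X) a b ≡ᵇ c) ≡ vecSumCheckᵇ k a b c
  plus≡ᵇ≡vecSumCheckᵇ X a b c ha hb hc = ≡true-ext
    (λ e → proj₂ check (trans (sym (decodeVec-encodeVec (decodeVec k a +v decodeVec k b))) (cong (decodeVec k) (≡ᵇ⇒≡′ e))))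
    (λ e → ≡⇒≡ᵇ′ (trans (cong encodeVec (proj₁ check e)) (encodeVec-decodeVec X c hc)))
    where
    check = ValidSums.vecSumCheckᵇ-valid listing k a b c ha hb hc

module Diagrams where

  diagramCase : Str → ℕ → ℕ → Bool
  diagramCase S zero r = dom S r
  diagramCase S (suc zero) r = uncurry₃ (λ a b c → dom S a ∧ dom S b ∧ dom S c ∧ (plus S a b ≡ᵇ c)) r
  diagramCase S (suc (suc zero)) r = dom S r ∧ (zer S ≡ᵇ r)
  diagramCase S (suc (suc (suc _))) r = false

  private
    diag-on : ∀ S n t r → unpair n ≡ (t , r) → diag S n ≡ diagramCase S t r
    diag-on S n zero r e rewrite e = refl
    diag-on S n (suc zero) r e rewrite e | unpair≡ r | unpair≡ (unpair₂ r) = refl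
    diag-on S n (suc (suc zero)) r e rewrite e = refl
    diag-on S n (suc (suc (suc t))) r e rewrite e = refl

  diag≡diagramCase : ∀ S n → diag S n ≡ diagramCase S (unpair₁ n) (unpair₂ n)
  diag≡diagramCase S n = diag-on S n (unpair₁ n) (unpair₂ n) (unpair≡ n)

  diag-pair : ∀ S t r → diag S (pair t r) ≡ diagramCase S t r
  diag-pair S t r = diag-on S (pair t r) t r (unpair-pair t r)

  diag-plus : ∀ S a b c → diag S (pair 1 (triple a b c)) ≡ (dom S a ∧ dom S b ∧ dom S c ∧ (plus S a b ≡ᵇ c))
  diag-plus S a b c = trans (diag-pair S 1 (triple a b c))
                            (uncurry₃-triple (λ a b c → dom S a ∧ dom S b ∧ dom S c ∧ (plus S a b ≡ᵇ c)) a b c)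

open Diagrams

module ComputablePrimeIndex {p : ℕ → ℕ} (listing : PrimeListing p)
                            (pC : Code 1) (pC-eval : ∀ n → Eval ∅ pC (n ∷ []) (p n)) where
  open PrimeIndexing listing

  signatureP : Signature
  signatureP = record { numOps = 1 ; boolOps = 0 ; numArity = λ _ → 1 ; boolArity = λ () }

  open Syntax signatureP
  open ArithmeticExpressions signatureP

  notIndexOfE : BExp 2
  notIndexOfE = notB (orB (notB (letB (v₁ ∷ []) primeE)) (eqB (opN zero (v₀ ∷ [])) v₁))

  interpretationP : Interpretation
  interpretationP = record { numOp = λ _ v → p (head v) ; boolOp = λ () }

  module _ (m : ℕ) where
    private
      pCₘ : Fin 1 → Code (1 + m)
      pCₘ _ = compC (withOracleIgnored pC) (projC zero ∷ [])

    primeIndexC : Code (suc m)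
    primeIndexC = muC (Compile.compileᴮ m pCₘ (λ ()) notIndexOfE)

    primeIndexC-eval : ∀ {O} (ys : Vec ℕ m) r → Eval O primeIndexC (r ∷ ys) (primeIndex r)
    primeIndexC-eval {O} ys r =
      eval-μ (isIndexOf r) (λ z → compileᴮ-sound notIndexOfE (z ∷ r ∷ [])) (primeIndex r) (proj₂ (primeIndex-least r))
      where
      pCₘ-eval : ∀ i (v : Vec ℕ 1) → Eval O (pCₘ i) (v ++ ys) (p (head v))
      pCₘ-eval i (x ∷ []) = ev-comp (ev-proj ∷ []) (relativise (pC-eval x))
      open Soundness signatureP O m ys interpretationP pCₘ (λ ()) pCₘ-eval (λ ())

module ComputableDiagram {p : ℕ → ℕ} (listing : PrimeListing p) (pC : Code 1) (pC-eval : ∀ n → Eval ∅ pC (n ∷ []) (p n))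
                         (k : ℕ) where
  open PrimeIndexing listing
  open ValidCodes listing
  open CodedGroups listing k
  open ComputablePrimeIndex listing pC pC-eval using (primeIndexC; primeIndexC-eval)

  signatureD : Signature
  signatureD = record { numOps = 1 ; boolOps = 1 ; numArity = λ _ → 1 ; boolArity = λ _ → 1 }

  open Syntax signatureD
  open ArithmeticExpressions signatureD

  at : ∀ {n} → NExp 1 → NExp n → NExp n
  at f e = letN (e ∷ []) f

  uncurry₃E : BExp 3 → BExp 1
  uncurry₃E e = letB (unpair₁N v₀ ∷ unpair₁N (unpair₂N v₀) ∷ unpair₂N (unpair₂N v₀) ∷ []) e

  primeFactorsInE : BExp 1
  primeFactorsInE = allB (add (lit 1) v₀)
    (orB (notB (andB (letB (v₀ ∷ []) primeE) (letB (v₀ ∷ v₁ ∷ []) dividesE))) (opB zero (opN zero (v₀ ∷ []) ∷ [])))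

  validPartsE : BExp 3
  validPartsE = andB (leB v₀ (lit 1))
    (andB (letB (add v₀ v₁ ∷ add (lit 1) v₂ ∷ []) coprimeE) (letB (add (lit 1) v₂ ∷ []) primeFactorsInE))

  validVecE : ℕ → BExp 1
  validVecE zero = eqB v₀ (lit 0)
  validVecE (suc k) = andB (letB (unpair₁N v₀ ∷ []) (uncurry₃E validPartsE)) (letB (unpair₂N v₀ ∷ []) (validVecE k))

  numerator⁺E numerator⁻E denominatorE : NExp 1
  numerator⁺E = mul (monus (lit 1) (unpair₁N v₀)) (unpair₁N (unpair₂N v₀))
  numerator⁻E = mul (unpair₁N v₀) (add (unpair₁N v₀) (unpair₁N (unpair₂N v₀)))
  denominatorE = add (lit 1) (unpair₂N (unpair₂N v₀))

  sumCheckE : BExp 3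
  sumCheckE = eqB
    (add (add (mul (at numerator⁺E v₂) (mul (at denominatorE v₀) (at denominatorE v₁)))
              (mul (at numerator⁻E v₀) (mul (at denominatorE v₁) (at denominatorE v₂))))
         (mul (at numerator⁻E v₁) (mul (at denominatorE v₀) (at denominatorE v₂))))
    (add (add (mul (at numerator⁻E v₂) (mul (at denominatorE v₀) (at denominatorE v₁)))
              (mul (at numerator⁺E v₀) (mul (at denominatorE v₁) (at denominatorE v₂))))
         (mul (at numerator⁺E v₁) (mul (at denominatorE v₀) (at denominatorE v₂))))

  vecSumCheckE : ℕ → BExp 3
  vecSumCheckE zero = tt
  vecSumCheckE (suc k) = andB (letB (unpair₁N v₀ ∷ unpair₁N v₁ ∷ unpair₁N v₂ ∷ []) sumCheckE)
                              (letB (unpair₂N v₀ ∷ unpair₂N v₁ ∷ unpair₂N v₂ ∷ []) (vecSumCheckE k))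

  plusCaseE : BExp 3
  plusCaseE = andB (letB (v₀ ∷ []) (validVecE k))
    (andB (letB (v₁ ∷ []) (validVecE k)) (andB (letB (v₂ ∷ []) (validVecE k)) (vecSumCheckE k)))

  diagramCaseE : BExp 2
  diagramCaseE = orB (andB (eqB v₀ (lit 0)) (letB (v₁ ∷ []) (validVecE k)))
    (orB (andB (eqB v₀ (lit 1)) (letB (v₁ ∷ []) (uncurry₃E plusCaseE)))
         (andB (eqB v₀ (lit 2)) (andB (letB (v₁ ∷ []) (validVecE k)) (eqB (lit (encodeVec (0v {k}))) v₁))))

  diagramE : BExp 1
  diagramE = letB (unpair₁N v₀ ∷ unpair₂N v₀ ∷ []) diagramCaseE

  interpretationD : (ℕ → Bool) → Interpretation
  interpretationD X = record { numOp = λ _ v → primeIndex (head v) ; boolOp = λ _ v → X (head v) }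

  module _ (X : ℕ → Bool) where
    open Semantics (interpretationD X)

    validVecE-sem : ∀ k n → ⟦ validVecE k ⟧ᴮ (n ∷ []) ≡ validVecᵇ X k n
    validVecE-sem zero n = refl
    validVecE-sem (suc k) n = cong (validℚᵇ X (unpair₁ n) ∧_) (validVecE-sem k (unpair₂ n))

    vecSumCheckE-sem : ∀ k a b c → ⟦ vecSumCheckE k ⟧ᴮ (a ∷ b ∷ c ∷ []) ≡ vecSumCheckᵇ k a b c
    vecSumCheckE-sem zero a b c = refl
    vecSumCheckE-sem (suc k) a b c =
      cong (sumCheckᵇ (unpair₁ a) (unpair₁ b) (unpair₁ c) ∧_) (vecSumCheckE-sem k (unpair₂ a) (unpair₂ b) (unpair₂ c))

    plusCaseE-sem : ∀ a b c → ⟦ plusCaseE ⟧ᴮ (a ∷ b ∷ c ∷ []) ≡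
                              (dom (𝒪 X) a ∧ dom (𝒪 X) b ∧ dom (𝒪 X) c ∧ (plus (𝒪 X) a b ≡ᵇ c))
    plusCaseE-sem a b c rewrite validVecE-sem k a | validVecE-sem k b | validVecE-sem k c | vecSumCheckE-sem k a b c
      with validVecᵇ X k a in ha | validVecᵇ X k b in hb | validVecᵇ X k c in hc
    ... | true | true | true = sym (plus≡ᵇ≡vecSumCheckᵇ X a b c ha hb hc)
    ... | true | true | false = refl
    ... | true | false | _ = refl
    ... | false | _ | _ = refl

    diagramCaseE-sem : ∀ t r → ⟦ diagramCaseE ⟧ᴮ (t ∷ r ∷ []) ≡ diagramCase (𝒪 X) t r
    diagramCaseE-sem zero r = trans (∨-identityʳ _) (validVecE-sem k r)
    diagramCaseE-sem (suc zero) r =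
      trans (∨-identityʳ _) (plusCaseE-sem (unpair₁ r) (unpair₁ (unpair₂ r)) (unpair₂ (unpair₂ r)))
    diagramCaseE-sem (suc (suc zero)) r rewrite validVecE-sem k r = refl
    diagramCaseE-sem (suc (suc (suc t))) r = refl

  module _ (m : ℕ) (XC : Code (1 + m)) where
    private
      primeIndexCₘ : Fin 1 → Code (1 + m)
      primeIndexCₘ _ = primeIndexC m
      XCₘ : Fin 1 → Code (1 + m)
      XCₘ _ = XC

    diagramC : Code (1 + m)
    diagramC = Compile.compileᴮ m primeIndexCₘ XCₘ diagramE

    diagramC-eval : ∀ {O} (ys : Vec ℕ m) (X : ℕ → Bool) → (∀ j → Eval O XC (j ∷ ys) (b2n (X j))) →
                    ∀ n → Eval O diagramC (n ∷ ys) (b2n (diag (𝒪 X) n))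
    diagramC-eval {O} ys X XC-eval n =
      subst (λ b → Eval O diagramC (n ∷ ys) (b2n b))
            (trans (diagramCaseE-sem X (unpair₁ n) (unpair₂ n)) (sym (diag≡diagramCase (𝒪 X) n)))
            (compileᴮ-sound diagramE (n ∷ []))
      where
      primeIndexCₘ-eval : ∀ i (v : Vec ℕ 1) → Eval O (primeIndexCₘ i) (v ++ ys) (primeIndex (head v))
      primeIndexCₘ-eval i (r ∷ []) = primeIndexC-eval m ys r
      XCₘ-eval : ∀ i (v : Vec ℕ 1) → Eval O (XCₘ i) (v ++ ys) (b2n (X (head v)))
      XCₘ-eval i (j ∷ []) = XC-eval j
      open Soundness signatureD O m ys (interpretationD X) primeIndexCₘ XCₘ primeIndexCₘ-eval XCₘ-eval

module Multiples {p : ℕ → ℕ} (listing : PrimeListing p) (k′ : ℕ) where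
  open PrimeListing listing
  open ValidCodes listing
  k = suc k′
  open CodedGroups listing k

  singleton : ℕ → ℕ → Bool
  singleton i j = j ≡ᵇ i

  e₁ : Vec ℚ k
  e₁ = 1ℚ ∷ 0v

  unitCode : ℕ
  unitCode = encodeVec e₁

  unitCode-∈ : ∀ X → unitCode ∈D 𝒪 X
  unitCode-∈ X = OVec⇒∈𝒪 X e₁ (↧ₙ≡1⇒InO (Primes X) 1ℚ refl ∷ OVec-0 (Primes X) k′)

  decodeVec-multiple : ∀ X m a → a ∈D 𝒪 X → decodeVec k (multiple (𝒪 X) m a) ≡ timesVec m (decodeVec k a)
  decodeVec-multiple X zero a ha = decodeVec-encodeVec 0v
  decodeVec-multiple X (suc m) a ha = trans (decodeVec-encodeVec (decodeVec k a +v decodeVec k (multiple (𝒪 X) m a)))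
                                            (cong (decodeVec k a +v_) (decodeVec-multiple X m a ha))

  -- If p_j y = e₁ then the first coordinate of y has p_j in its denominator.
  multiple≡unitCode⇒∈ : ∀ X j y → y ∈D 𝒪 X → multiple (𝒪 X) (p j) y ≡ unitCode → X j ≡ true
  multiple≡unitCode⇒∈ X j y hy eq with ∈𝒪⇒OVec X y hy
  ... | q∈O ∷ _ = subst (λ i → X i ≡ true) (inj _ _ pi≡pj) Xi
    where
    q = decodeℚ (unpair₁ y)
    decoded : times (p j) q ∷ timesVec (p j) (decodeVec k′ (unpair₂ y)) ≡ e₁
    decoded = trans (sym (timesVec-∷ (p j) q _))
      (trans (sym (decodeVec-multiple X (p j) y hy)) (trans (cong (decodeVec k) eq) (decodeVec-encodeVec e₁)))
    pj∣↧q : p j ∣ ↧ₙ q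
    pj∣↧q = divides ℤ.∣ ↥ q ∣ (trans (times≡1⇒↧ₙ≡ (p j) q (proj₁ (∷-injective decoded))) (*-comm (p j) _))
    pj∈V = q∈O (p j) (all-prime j) pj∣↧q
    Xi = proj₁ (proj₂ pj∈V)
    pi≡pj = proj₂ (proj₂ pj∈V)

  p≢0 : ∀ i → p i ≢ 0
  p≢0 i pi≡0 = ≢-nonZero⁻¹ (p i) {{prime⇒nonZero (all-prime i)}} pi≡0

  reciprocalCode : ℕ → ℕ
  reciprocalCode i = encodeVec (1/ℕ (p i) ∷ 0v {k′})

  reciprocalCode-∈ : ∀ i → reciprocalCode i ∈D 𝒪 (singleton i)
  reciprocalCode-∈ i = OVec⇒∈𝒪 (singleton i) (1/ℕ (p i) ∷ 0v) (1/p∈O ∷ OVec-0 _ k′)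
    where
    1/p∈O : InO (Primes (singleton i)) (1/ℕ (p i))
    1/p∈O r r-prime r∣ = i , ≡⇒≡ᵇ′ {i} refl , sym (r≡pi (p i) refl r∣)
      where
      r≡pi : ∀ n → n ≡ p i → r ∣ ↧ₙ (1/ℕ n) → r ≡ p i
      r≡pi zero 0≡pi _ = ⊥-elim (p≢0 i (sym 0≡pi))
      r≡pi (suc m) n≡pi r∣n with prime⇒irreducible (subst Prime (sym n≡pi) (all-prime i)) r∣n
      ... | inj₁ r≡1 = ⊥-elim (prime≢1 r-prime r≡1)
      ... | inj₂ r≡n = trans r≡n n≡pi

  multiple-reciprocalCode : ∀ i → multiple (𝒪 (singleton i)) (p i) (reciprocalCode i) ≡ unitCode
  multiple-reciprocalCode i = trans (sym (encodeVec-decodeVec (singleton i) _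
                                        (multiple-∈ (𝒪-ClosedSubset (singleton i)) (p i) _ (reciprocalCode-∈ i))))
                                    (cong encodeVec decoded)
    where
    decoded : decodeVec k (multiple (𝒪 (singleton i)) (p i) (reciprocalCode i)) ≡ e₁
    decoded = begin
      decodeVec k (multiple (𝒪 (singleton i)) (p i) (reciprocalCode i))
        ≡⟨ decodeVec-multiple (singleton i) (p i) _ (reciprocalCode-∈ i) ⟩
      timesVec (p i) (decodeVec k (reciprocalCode i))
        ≡⟨ cong (timesVec (p i)) (decodeVec-encodeVec (1/ℕ (p i) ∷ 0v)) ⟩
      timesVec (p i) (1/ℕ (p i) ∷ 0v)
        ≡⟨ timesVec-∷ (p i) _ 0v ⟩
      times (p i) (1/ℕ (p i)) ∷ timesVec (p i) 0v
        ≡⟨ cong₂ _∷_ (times-1/ℕ (p i) (p≢0 i)) (timesVec-0v (p i)) ⟩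
      e₁ ∎
      where open ≡-Reasoning

module IntegerLattice {p : ℕ → ℕ} (listing : PrimeListing p) where
  open ValidCodes listing
  open import Data.Vec.Membership.Propositional using (_∈_)
  open import Data.Vec.Relation.Unary.Any using (here; there)

  none : ℕ → Bool
  none _ = false

  ℤᵏ : ℕ → Str
  ℤᵏ k = CodedGroups.𝒪 listing k none

  generatorCount : ℕ → ℕ
  generatorCount zero = 0
  generatorCount (suc k) = suc (suc (generatorCount k))

  generatorVecs : ∀ k → Vec (Vec ℚ k) (generatorCount k)
  generatorVecs zero = []
  generatorVecs (suc k) = (1ℚ ∷ 0v) ∷ (fromℤ -[1+ 0 ] ∷ 0v) ∷ Vec.map (0ℚ ∷_) (generatorVecs k)

  generators : ∀ k → Vec ℕ (generatorCount k)
  generators k = Vec.map encodeVec (generatorVecs k)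

  Integral : ℚ → Set
  Integral q = ↧ₙ q ≡ 1

  generatorVecs-integral : ∀ k → All (All Integral) (generatorVecs k)
  generatorVecs-integral zero = []
  generatorVecs-integral (suc k) = (refl ∷ 0v-integral k) ∷ (refl ∷ 0v-integral k) ∷ shifted (generatorVecs-integral k)
    where
    0v-integral : ∀ k → All Integral (0v {k})
    0v-integral zero = []
    0v-integral (suc k) = refl ∷ 0v-integral k
    shifted : ∀ {n} {G : Vec (Vec ℚ k) n} → All (All Integral) G → All (All Integral) (Vec.map (0ℚ ∷_) G)
    shifted [] = []
    shifted (h ∷ hs) = (refl ∷ h) ∷ shifted hs

  Generated : ∀ k → ℕ → Set
  Generated k = Gen (ℤᵏ k) (_∈ generators k)

  private
    plus-pair : ∀ k x y a b → plus (ℤᵏ (suc k)) (pair (encodeℚ x) a) (pair (encodeℚ y) b)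
                              ≡ encodeVec ((x ℚ.+ y) ∷ (decodeVec k a +v decodeVec k b))
    plus-pair k x y a b =
      cong encodeVec (cong₂ _∷_ (cong₂ ℚ._+_ (head≡ x a) (head≡ y b)) (cong₂ _+v_ (tail≡ x a) (tail≡ y b)))
      where
      head≡ : ∀ x a → decodeℚ (unpair₁ (pair (encodeℚ x) a)) ≡ x
      head≡ x a = trans (cong decodeℚ (unpair₁-pair (encodeℚ x) a)) (decodeℚ-encodeℚ x)
      tail≡ : ∀ x a → decodeVec k (unpair₂ (pair (encodeℚ x) a)) ≡ decodeVec k a
      tail≡ x a = cong (decodeVec k) (unpair₂-pair (encodeℚ x) a)

    plus-∷ : ∀ k x y (u w : Vec ℚ k) →
             plus (ℤᵏ (suc k)) (encodeVec (x ∷ u)) (encodeVec (y ∷ w)) ≡ encodeVec ((x ℚ.+ y) ∷ (u +v w))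
    plus-∷ k x y u w = trans (plus-pair k x y (encodeVec u) (encodeVec w))
                             (cong (λ v → encodeVec ((x ℚ.+ y) ∷ v)) (cong₂ _+v_ (decodeVec-encodeVec u) (decodeVec-encodeVec w)))

    shift : ℕ → ℕ
    shift a = pair (encodeℚ 0ℚ) a

    shift-plus : ∀ k a b → shift (plus (ℤᵏ k) a b) ≡ plus (ℤᵏ (suc k)) (shift a) (shift b)
    shift-plus k a b = sym (trans (plus-pair k 0ℚ 0ℚ a b)
                                  (cong (λ q → encodeVec (q ∷ (decodeVec k a +v decodeVec k b))) (ℚ.+-identityˡ 0ℚ)))

    ∈-shift : ∀ {k n x} (G : Vec (Vec ℚ k) n) →
              x ∈ Vec.map encodeVec G → shift x ∈ Vec.map encodeVec (Vec.map (0ℚ ∷_) G)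
    ∈-shift (_ ∷ _) (here refl) = here refl
    ∈-shift (_ ∷ G) (there x∈G) = there (∈-shift G x∈G)

    Generated-shift : ∀ k {a} → Generated k a → Generated (suc k) (shift a)
    Generated-shift k (g-gen a∈) = g-gen (there (there (∈-shift (generatorVecs k) a∈)))
    Generated-shift k g-zer = g-zer
    Generated-shift k (g-plus {a} {b} ga gb) =
      subst (Generated (suc k)) (sym (shift-plus k a b)) (g-plus (Generated-shift k ga) (Generated-shift k gb))

    Generated-first : ∀ k z → Generated (suc k) (encodeVec (fromℤ z ∷ 0v {k}))
    Generated-first k (+ zero) = g-zer
    Generated-first k (+ suc n) =
      subst (Generated (suc k)) (trans (plus-∷ k 1ℚ (fromℤ (+ n)) 0v 0v)
                                       (cong₂ (λ q v → encodeVec (q ∷ v)) (fromℤ-+ (+ 1) (+ n)) (+v-identityˡ (0v {k}))))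
            (g-plus (g-gen (here refl)) (Generated-first k (+ n)))
    Generated-first k -[1+ zero ] = g-gen (there (here refl))
    Generated-first k -[1+ suc n ] =
      subst (Generated (suc k)) (trans (plus-∷ k (fromℤ -[1+ 0 ]) (fromℤ -[1+ n ]) 0v 0v)
                                       (cong₂ (λ q v → encodeVec (q ∷ v)) (fromℤ-+ -[1+ 0 ] -[1+ n ]) (+v-identityˡ (0v {k}))))
            (g-plus (g-gen (there (here refl))) (Generated-first k -[1+ n ]))

  Generated-integral : ∀ k (w : Vec ℚ k) → All Integral w → Generated k (encodeVec w)
  Generated-integral zero [] [] = g-zer
  Generated-integral (suc k) (q ∷ w) (q-integral ∷ w-integral) =
    subst (Generated (suc k)) sum≡ (g-plus (Generated-first k (↥ q)) (Generated-shift k (Generated-integral k w w-integral)))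
    where
    sum≡ : plus (ℤᵏ (suc k)) (encodeVec (fromℤ (↥ q) ∷ 0v {k})) (encodeVec (0ℚ ∷ w)) ≡ encodeVec (q ∷ w)
    sum≡ = trans (plus-∷ k (fromℤ (↥ q)) 0ℚ 0v w)
                 (cong₂ (λ q v → encodeVec (q ∷ v)) (trans (ℚ.+-identityʳ _) (sym (fromℤ-↥ q q-integral))) (+v-identityˡ w))

  no-primes : ∀ r → ¬ Primes none r
  no-primes r (_ , () , _)

  ℤᵏ-finitelyGenerated : ∀ k → FinitelyGenerated (ℤᵏ k)
  ℤᵏ-finitelyGenerated k = generatorCount k , generators k , generators-∈ (generatorVecs k) (generatorVecs-integral k) , λ a ha →
    subst (Generated k) (encodeVec-decodeVec none a ha)
          (Generated-integral k (decodeVec k a) (All.map (λ {q} → InO-∅⇒↧ₙ≡1 no-primes q) (∈𝒪⇒OVec none a ha)))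
    where
    open CodedGroups listing k
    generators-∈ : ∀ {n} (G : Vec (Vec ℚ k) n) → All (All Integral) G → All (_∈D ℤᵏ k) (Vec.map encodeVec G)
    generators-∈ [] [] = []
    generators-∈ (u ∷ G) (h ∷ hs) =
      OVec⇒∈𝒪 none u (All.map (λ {q} → ↧ₙ≡1⇒InO (Primes none) q) h) ∷ generators-∈ G hs

module EmbeddingCriterion {p : ℕ → ℕ} (listing : PrimeListing p) (k′ : ℕ) where
  open ValidCodes listing
  open Multiples listing k′
  open CodedGroups listing k
  open IntegerLattice listing using (none; ℤᵏ)

  unitCode-∈ℤᵏ : unitCode ∈D ℤᵏ k
  unitCode-∈ℤᵏ = unitCode-∈ none

  singleton⊂ : ∀ X i → X i ≡ true → 𝒪 (singleton i) ⊂ 𝒪 X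
  singleton⊂ X i Xi = 𝒪-mono (singleton i) X
    λ { r (j , j≡ᵇi , pj≡r) → j , subst (λ t → X t ≡ true) (sym (≡ᵇ⇒≡′ j≡ᵇi)) Xi , pj≡r }

  ℤᵏ⊂ : ∀ X → ℤᵏ k ⊂ 𝒪 X
  ℤᵏ⊂ X = 𝒪-mono none X λ { r (_ , () , _) }

  Embedding-reciprocal : ∀ {i T σ} → Embedding (𝒪 (singleton i)) T σ → multiple T (p i) (σ (reciprocalCode i)) ≡ σ unitCode
  Embedding-reciprocal {i} {σ = σ} emb =
    trans (sym (Embedding-multiple emb (𝒪-ClosedSubset (singleton i)) (p i) _ (reciprocalCode-∈ i)))
          (cong σ (multiple-reciprocalCode i))

  EmbId⇒∈ : ∀ X i → EmbId (𝒪 (singleton i)) (𝒪 X) (ℤᵏ k) → X i ≡ true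
  EmbId⇒∈ X i (σ , emb , fixes) =
    multiple≡unitCode⇒∈ X i (σ (reciprocalCode i)) (Embedding.emb-dom emb _ (reciprocalCode-∈ i))
    (trans (Embedding-reciprocal emb) (fixes unitCode unitCode-∈ℤᵏ))

  ∈⇒EmbId : ∀ X i → X i ≡ true → EmbId (𝒪 (singleton i)) (𝒪 X) (ℤᵏ k)
  ∈⇒EmbId X i Xi = (λ x → x) , ⊂⇒Embedding (singleton⊂ X i Xi) , λ _ _ → refl

  module _ {X B τ} (iso : Iso (𝒪 X) B τ) where
    open Iso iso
    open Embedding iso-emb

    EmbOver⇒divisible : ∀ i → EmbOver (𝒪 (singleton i)) B τ (ℤᵏ k) →
                        Σ ℕ λ y → y ∈D B × multiple B (p i) y ≡ τ unitCode
    EmbOver⇒divisible i (σ , emb , agrees) = σ (reciprocalCode i) , Embedding.emb-dom emb _ (reciprocalCode-∈ i) ,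
      trans (Embedding-reciprocal emb) (agrees unitCode unitCode-∈ℤᵏ)

    divisible⇒EmbOver : ∀ j y → y ∈D B → multiple B (p j) y ≡ τ unitCode → EmbOver (𝒪 (singleton j)) B τ (ℤᵏ k)
    divisible⇒EmbOver j y hy eq with iso-surj y hy
    ... | y′ , hy′ , refl = τ , Embedding-restrict (singleton⊂ X j Xj) iso-emb , λ _ _ → refl
      where
      multiple≡ : multiple (𝒪 X) (p j) y′ ≡ unitCode
      multiple≡ = emb-inj _ _ (multiple-∈ (𝒪-ClosedSubset X) (p j) y′ hy′) (unitCode-∈ X)
                    (trans (Embedding-multiple iso-emb (𝒪-ClosedSubset X) (p j) y′ hy′) eq)
      Xj : X j ≡ true
      Xj = multiple≡unitCode⇒∈ X j y′ hy′ multiple≡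

-- Searching the atomic diagram of B for the relevant atomic facts computes its zero, addition and multiples.
module ComputingIn {p : ℕ → ℕ} (pC : Code 1) (pC-eval : ∀ n → Eval ∅ pC (n ∷ []) (p n))
                   (B : Str) (B-closed : ClosedSubset B) where
  open ClosedSubset B-closed

  dom-diag : ∀ a → diag B (pair 0 a) ≡ dom B a
  dom-diag a = diag-pair B 0 a

  isZeroᴮ : ℕ → Bool
  isZeroᴮ c = diag B (pair 2 c)

  zeroᴮ-least : Σ ℕ (Least isZeroᴮ)
  zeroᴮ-least = least isZeroᴮ (zer B) (trans (diag-pair B 2 (zer B)) (∧-intro zer-∈ (≡⇒≡ᵇ′ {zer B} refl)))

  zeroᴮ : ℕ
  zeroᴮ = proj₁ zeroᴮ-least

  zeroᴮ≡zer : zeroᴮ ≡ zer B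
  zeroᴮ≡zer = sym (≡ᵇ⇒≡′ (∧-elimʳ {dom B zeroᴮ} (trans (sym (diag-pair B 2 zeroᴮ)) (proj₁ (proj₂ zeroᴮ-least)))))

  -- The escape clause makes the search terminate also outside the universe of B.
  isSumᴮ : ℕ → ℕ → ℕ → Bool
  isSumᴮ a b c = diag B (pair 1 (triple a b c)) ∨ (not (diag B (pair 0 a)) ∨ not (diag B (pair 0 b)))

  private
    some-sum : ∀ a b → Σ ℕ λ c → isSumᴮ a b c ≡ true
    some-sum a b with dom B a in ha | dom B b in hb
    ... | false | _ = 0 , ∨-introʳ {diag B (pair 1 (triple a b 0))} (∨-introˡ (not-intro (trans (dom-diag a) ha)))
    ... | true | false = 0 , ∨-introʳ {diag B (pair 1 (triple a b 0))}
                               (∨-introʳ {not (diag B (pair 0 a))} (not-intro (trans (dom-diag b) hb)))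
    ... | true | true = plus B a b , ∨-introˡ (trans (diag-plus B a b (plus B a b))
                                      (∧-intro ha (∧-intro hb (∧-intro (plus-∈ a b ha hb) (≡⇒≡ᵇ′ {plus B a b} refl)))))

  plusᴮ-least : ∀ a b → Σ ℕ (Least (isSumᴮ a b))
  plusᴮ-least a b = least (isSumᴮ a b) (proj₁ (some-sum a b)) (proj₂ (some-sum a b))

  plusᴮ : ℕ → ℕ → ℕ
  plusᴮ a b = proj₁ (plusᴮ-least a b)

  plusᴮ≡plus : ∀ a b → a ∈D B → b ∈D B → plusᴮ a b ≡ plus B a b
  plusᴮ≡plus a b ha hb with ∨-elim {diag B (pair 1 (triple a b (plusᴮ a b)))} (proj₁ (proj₂ (plusᴮ-least a b)))
  ... | inj₁ h =
    sym (≡ᵇ⇒≡′ (∧-elimʳ {dom B c} (∧-elimʳ {dom B b} (∧-elimʳ {dom B a} (trans (sym (diag-plus B a b c)) h)))))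
    where c = plusᴮ a b
  ... | inj₂ h with ∨-elim {not (diag B (pair 0 a))} h
  ...   | inj₁ h′ = ⊥-elim (true≢false (trans (sym (trans (dom-diag a) ha)) (not-elim h′)))
  ...   | inj₂ h′ = ⊥-elim (true≢false (trans (sym (trans (dom-diag b) hb)) (not-elim h′)))

  multipleᴮ : ℕ → ℕ → ℕ
  multipleᴮ m y = iterate zeroᴮ (λ _ acc → plusᴮ y acc) m

  multipleᴮ≡multiple : ∀ y → y ∈D B → ∀ m → multipleᴮ m y ≡ multiple B m y
  multipleᴮ≡multiple y hy zero = zeroᴮ≡zer
  multipleᴮ≡multiple y hy (suc m) = trans (cong (plusᴮ y) (multipleᴮ≡multiple y hy m))
                                          (plusᴮ≡plus y (multiple B m y) hy (multiple-∈ B-closed m y hy))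

  signature₁ : Signature
  signature₁ = record { numOps = 0 ; boolOps = 1 ; numArity = λ () ; boolArity = λ _ → 1 }

  interpretation₁ : Syntax.Interpretation signature₁
  interpretation₁ = record { numOp = λ () ; boolOp = λ _ v → diag B (head v) }

  oracleCₘ : Fin 1 → Code (1 + 0)
  oracleCₘ _ = oracleC

  oracleCₘ-eval : ∀ (i : Fin 1) (v : Vec ℕ 1) → Eval (diag B) (oracleCₘ i) (v ++ []) (b2n (diag B (head v)))
  oracleCₘ-eval i (x ∷ []) = ev-orc

  module ArithmeticCodes where
    open Syntax signature₁
    open Compile 0 (λ ()) oracleCₘ
    open Soundness signature₁ (diag B) 0 [] interpretation₁ (λ ()) oracleCₘ (λ ()) oracleCₘ-eval

    inDiagram : ∀ {n} → NExp n → BExp n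
    inDiagram e = opB zero (e ∷ [])

    notZeroE : BExp 1
    notZeroE = notB (inDiagram (pairN (lit 2) v₀))

    notSumE : BExp 3
    notSumE = notB (orB (inDiagram (pairN (lit 1) (pairN v₁ (pairN v₂ v₀))))
                        (orB (notB (inDiagram (pairN (lit 0) v₁))) (notB (inDiagram (pairN (lit 0) v₂)))))

    zeroᴮC : Code 0
    zeroᴮC = muC (compileᴮ notZeroE)

    plusᴮC : Code 2
    plusᴮC = muC (compileᴮ notSumE)

    zeroᴮC-eval : Eval (diag B) zeroᴮC [] zeroᴮ
    zeroᴮC-eval = eval-μ isZeroᴮ (λ c → compileᴮ-sound notZeroE (c ∷ [])) zeroᴮ (proj₂ zeroᴮ-least)

    plusᴮC-eval : ∀ a b → Eval (diag B) plusᴮC (a ∷ b ∷ []) (plusᴮ a b)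
    plusᴮC-eval a b =
      eval-μ (isSumᴮ a b) (λ c → compileᴮ-sound notSumE (c ∷ a ∷ b ∷ [])) (plusᴮ a b) (proj₂ (plusᴮ-least a b))

  arity₂ : Fin 3 → ℕ
  arity₂ zero = 1
  arity₂ (suc zero) = 0
  arity₂ (suc (suc zero)) = 2

  signature₂ : Signature
  signature₂ = record { numOps = 3 ; boolOps = 1 ; numArity = arity₂ ; boolArity = λ _ → 1 }

  numOp₂ : (i : Fin 3) → Vec ℕ (arity₂ i) → ℕ
  numOp₂ zero v = p (head v)
  numOp₂ (suc zero) _ = zeroᴮ
  numOp₂ (suc (suc zero)) v = plusᴮ (head v) (head (tail v))

  interpretation₂ : Syntax.Interpretation signature₂
  interpretation₂ = record { numOp = numOp₂ ; boolOp = λ _ v → diag B (head v) }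

  numOpC₂ : (i : Fin 3) → Code (arity₂ i + 0)
  numOpC₂ zero = compC (withOracleIgnored pC) (projC zero ∷ [])
  numOpC₂ (suc zero) = ArithmeticCodes.zeroᴮC
  numOpC₂ (suc (suc zero)) = ArithmeticCodes.plusᴮC

  numOpC₂-eval : ∀ (i : Fin 3) (v : Vec ℕ (arity₂ i)) → Eval (diag B) (numOpC₂ i) (v ++ []) (numOp₂ i v)
  numOpC₂-eval zero (x ∷ []) = ev-comp (ev-proj ∷ []) (relativise (pC-eval x))
  numOpC₂-eval (suc zero) [] = ArithmeticCodes.zeroᴮC-eval
  numOpC₂-eval (suc (suc zero)) (a ∷ b ∷ []) = ArithmeticCodes.plusᴮC-eval a b

  chosen : ℕ → ℕ → ℕ → ℕ
  chosen i j t = if t ≡ᵇ 0 then i else j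

  found : ℕ → ℕ → ℕ → ℕ → Bool
  found b₀ i j z =
    (unpair₁ z ≤ᵇ 1) ∧ (diag B (pair 0 (unpair₂ z)) ∧ (multipleᴮ (p (chosen i j (unpair₁ z))) (unpair₂ z) ≡ᵇ b₀))

  module DivisorSearch (b₀ : ℕ) where
    open Syntax signature₂
    open Compile 0 numOpC₂ oracleCₘ
    open Soundness signature₂ (diag B) 0 [] interpretation₂ numOpC₂ oracleCₘ numOpC₂-eval oracleCₘ-eval

    multipleE : NExp 2
    multipleE = iterN v₀ (opN (suc zero) []) (opN (suc (suc zero)) (v₃ ∷ v₁ ∷ []))

    notFoundE : BExp 3
    notFoundE = notB (andB (leB (unpair₁N v₀) (lit 1)) (andB (opB zero (pairN (lit 0) (unpair₂N v₀) ∷ []))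
      (eqB (letN (opN zero (ifN (eqB (unpair₁N v₀) (lit 0)) v₁ v₂ ∷ []) ∷ unpair₂N v₀ ∷ []) multipleE) (lit b₀))))

    decisionC : Code 2
    decisionC = compC unpair₁C (muC (compileᴮ notFoundE) ∷ [])

    decisionC-eval : ∀ i j z → Least (found b₀ i j) z → Eval (diag B) decisionC (i ∷ j ∷ []) (unpair₁ z)
    decisionC-eval i j z z-least = ev-comp₁
      (eval-μ (found b₀ i j) (λ z′ → compileᴮ-sound notFoundE (z′ ∷ i ∷ j ∷ [])) z z-least) (eval-unpair₁ z)

  found-pair : ∀ b₀ i j t y → t ≤ 1 → y ∈D B → multiple B (p (chosen i j t)) y ≡ b₀ → found b₀ i j (pair t y) ≡ true
  found-pair b₀ i j t y t≤1 hy eq rewrite unpair₁-pair t y | unpair₂-pair t y =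
    ∧-intro (≤⇒≤ᵇ′ t≤1) (∧-intro (trans (dom-diag y) hy)
            (≡⇒≡ᵇ′ (trans (multipleᴮ≡multiple y hy (p (chosen i j t))) eq)))

  found⇒ : ∀ b₀ i j z → found b₀ i j z ≡ true →
           unpair₁ z ≤ 1 × unpair₂ z ∈D B × multiple B (p (chosen i j (unpair₁ z))) (unpair₂ z) ≡ b₀
  found⇒ b₀ i j z h = ≤ᵇ⇒≤′ (∧-elimˡ h) , hy ,
    trans (sym (multipleᴮ≡multiple y hy (p (chosen i j t))))
          (≡ᵇ⇒≡′ (∧-elimʳ {diag B (pair 0 y)} (∧-elimʳ {t ≤ᵇ 1} h)))
    where
    t = unpair₁ z
    y = unpair₂ z
    hy : y ∈D B
    hy = trans (sym (dom-diag y)) (∧-elimˡ (∧-elimʳ {t ≤ᵇ 1} h))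

  decisionC-outcome : ∀ b₀ i j t₀ y₀ → t₀ ≤ 1 → y₀ ∈D B → multiple B (p (chosen i j t₀)) y₀ ≡ b₀ →
    Σ ℕ λ t → Eval (diag B) (DivisorSearch.decisionC b₀) (i ∷ j ∷ []) t × t ≤ 1 ×
              Σ ℕ λ y → y ∈D B × multiple B (p (chosen i j t)) y ≡ b₀
  decisionC-outcome b₀ i j t₀ y₀ t₀≤1 hy₀ eq₀ =
    unpair₁ z , DivisorSearch.decisionC-eval b₀ i j z z-least , proj₁ z-found , unpair₂ z , proj₂ z-found
    where
    least-found = least (found b₀ i j) (pair t₀ y₀) (found-pair b₀ i j t₀ y₀ t₀≤1 hy₀ eq₀)
    z = proj₁ least-found
    z-least = proj₂ least-found
    z-found = found⇒ b₀ i j z (proj₁ z-least)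

module Construction {p : ℕ → ℕ} (listing : PrimeListing p) (pC : Code 1) (pC-eval : ∀ n → Eval ∅ pC (n ∷ []) (p n))
                    (k′ : ℕ) where
  open ValidCodes listing
  open Multiples listing k′
  open CodedGroups listing k
  open IntegerLattice listing using (none; ℤᵏ; no-primes; ℤᵏ-finitelyGenerated)
  open EmbeddingCriterion listing k′
  open ComputableDiagram listing pC pC-eval k using (diagramC; diagramC-eval)

  ℤᵏ-Presents : Presents (ℤᵏ k) IntVec (decodeVec k)
  ℤᵏ-Presents = Presents-⇔ (λ _ → All.map (λ {q} → InO-∅⇒↧ₙ≡1 no-primes q))
                           (λ _ → All.map (λ {q} → ↧ₙ≡1⇒InO (Primes none) q))
                           (𝒪-Presents none)

  singleton-Presents : ∀ i → Presents (𝒪 (singleton i)) (OVec (λ r → r ≡ p i)) (decodeVec k)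
  singleton-Presents i = Presents-⇔ (λ _ → All.map (λ {q} → InO-mono to {q})) (λ _ → All.map (λ {q} → InO-mono from {q}))
                                    (𝒪-Presents (singleton i))
    where
    to : ∀ r → Primes (singleton i) r → r ≡ p i
    to r (j , j≡ᵇi , pj≡r) = trans (sym pj≡r) (cong p (≡ᵇ⇒≡′ j≡ᵇi))
    from : ∀ r → r ≡ p i → Primes (singleton i) r
    from r r≡pi = i , ≡⇒≡ᵇ′ {i} refl , sym r≡pi

  Embeds : ℕ → Str → (ℕ → ℕ) → Set
  Embeds i B τ = EmbOver (𝒪 (singleton i)) B τ (ℤᵏ k)

  decision : ∀ X B τ → Iso (𝒪 X) B τ → Σ (Code 2) λ c → ∀ i j →
    (Embeds i B τ × ¬ Embeds j B τ → Eval (diag B) c (i ∷ j ∷ []) 0) ×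
    (Embeds j B τ × ¬ Embeds i B τ → Eval (diag B) c (i ∷ j ∷ []) 1)
  decision X B τ iso = decisionC , λ i j →
    (λ (i-embeds , ¬j-embeds) → answer-0 ¬j-embeds (outcome i j 0 z≤n i-embeds)) ,
    (λ (j-embeds , ¬i-embeds) → answer-1 ¬i-embeds (outcome i j 1 (s≤s z≤n) j-embeds))
    where
    open ComputingIn pC pC-eval B (Iso⇒ClosedSubset iso (𝒪-ClosedSubset X))
    b₀ = τ unitCode
    open DivisorSearch b₀ using (decisionC)

    Outcome : ℕ → ℕ → Set
    Outcome i j = Σ ℕ λ t → Eval (diag B) decisionC (i ∷ j ∷ []) t × t ≤ 1 × Embeds (chosen i j t) B τ

    outcome : ∀ i j t₀ → t₀ ≤ 1 → Embeds (chosen i j t₀) B τ → Outcome i j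
    outcome i j t₀ t₀≤1 embeds = t , evaluates , t≤1 , divisible⇒EmbOver iso (chosen i j t) y hy eq
      -- Plain projections: a with-abstraction or pattern let here would normalise the large code decisionC.
      where
      divisor = EmbOver⇒divisible iso (chosen i j t₀) embeds
      result = decisionC-outcome b₀ i j t₀ (proj₁ divisor) t₀≤1 (proj₁ (proj₂ divisor)) (proj₂ (proj₂ divisor))
      t = proj₁ result
      evaluates = proj₁ (proj₂ result)
      t≤1 = proj₁ (proj₂ (proj₂ result))
      y = proj₁ (proj₂ (proj₂ (proj₂ result)))
      hy = proj₁ (proj₂ (proj₂ (proj₂ (proj₂ result))))
      eq = proj₂ (proj₂ (proj₂ (proj₂ (proj₂ result))))

    answer-0 : ∀ {i j} → ¬ Embeds j B τ → Outcome i j → Eval (diag B) decisionC (i ∷ j ∷ []) 0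
    answer-0 _ (zero , evaluates , _ , _) = evaluates
    answer-0 ¬j-embeds (suc zero , _ , _ , j-embeds) = ⊥-elim (¬j-embeds j-embeds)
    answer-0 _ (suc (suc _) , _ , s≤s () , _)

    answer-1 : ∀ {i j} → ¬ Embeds i B τ → Outcome i j → Eval (diag B) decisionC (i ∷ j ∷ []) 1
    answer-1 _ (suc zero , evaluates , _ , _) = evaluates
    answer-1 ¬i-embeds (zero , _ , _ , i-embeds) = ⊥-elim (¬i-embeds i-embeds)
    answer-1 _ (suc (suc _) , _ , s≤s () , _)

  richter : Richter (InC k) (λ i → 𝒪 (singleton i)) (ℤᵏ k) 𝒪
  richter = record
    { closedIso = λ S T τ iso → InC-Iso k iso
    ; seqC = λ i → 𝒪-InC (singleton i)
    ; seqComp = compC (diagramC 1 eqC) (π₁ ∷ π₀ ∷ []) ,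
                λ i n → ev-comp (ev-proj ∷ ev-proj ∷ []) (diagramC-eval 1 eqC (i ∷ []) (singleton i) (λ j → eval-eq j i) n)
    ; A-C = 𝒪-InC none
    ; A-fg = ℤᵏ-finitelyGenerated k
    ; A-sub = λ i → ℤᵏ⊂ (singleton i)
    ; AX-C = 𝒪-InC
    ; AX-sub = ℤᵏ⊂
    ; AX-T = λ X → diagramC 0 oracleC , diagramC-eval 0 oracleC [] X (λ j → ev-orc)
    ; AX-emb = λ X i → EmbId⇒∈ X i , ∈⇒EmbId X i
    ; decide = decision }

mainTheorem6 : (k : ℕ) → 1 ≤ k → (p : ℕ → ℕ) → PrimeListing p → ComputableFun p →
    Σ Str λ A → Σ (ℕ → Str) λ As → Σ ((ℕ → Bool) → Str) λ AX →
      (Σ (ℕ → Vec ℚ k) λ ιA → Presents A IntVec ιA ×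
        (∀ i → Σ (ℕ → Vec ℚ k) λ ι →
          Presents (As i) (OVec (λ r → r ≡ p i)) ι × (∀ a → a ∈D A → ι a ≡ ιA a)) ×
        (∀ X → Σ (ℕ → Vec ℚ k) λ ι →
          Presents (AX X) (OVec (λ r → Σ ℕ λ i → X i ≡ true × p i ≡ r)) ι ×
          (∀ a → a ∈D A → ι a ≡ ιA a))) ×
      Richter (InC k) As A AX
mainTheorem6 (suc k′) (s≤s z≤n) p listing (pC , pC-eval) =
  ℤᵏ (suc k′) , (λ i → 𝒪 (singleton i)) , 𝒪 ,
  (decodeVec (suc k′) , ℤᵏ-Presents ,
   (λ i → decodeVec (suc k′) , singleton-Presents i , λ _ _ → refl) ,
   (λ X → decodeVec (suc k′) , 𝒪-Presents X , λ _ _ → refl)) ,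
  richter
  where
  open IntegerLattice listing using (ℤᵏ)
  open Multiples listing k′ using (singleton)
  open CodedGroups listing (suc k′) using (𝒪; 𝒪-Presents)
  open Construction listing pC pC-eval k′ using (ℤᵏ-Presents; singleton-Presents; richter)
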